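{- Let $k$ be an étale cubic algebra over $\mathbb{Q}$ and let $\mathcal{O}$ be a cubic ring contained in $k$ (an order of $k$). Assume that the index $f=(\mathcal{O}_k:\mathcal{O})$ is square free. Then there exists a normalized basis $\{1,\omega,\theta\}$ of $\mathcal{O}_k$ such that $\mathcal{O}=[1,f\omega,\theta]$ and $\mathfrak{f}=[f,f\omega,\theta]$ is the conductor of $\mathcal{O}$. In particular $\mathcal{O}=\mathbb{Z}+\mathfrak{f}$ and $N(\mathfrak{f})=f^2$.
   Context: An étale cubic algebra over $\mathbb{Q}$ is a direct sum of number fields of total degree $3$; $\mathcal{O}_k$ is its maximal order (direct sum of rings of integers). A normalized basis of $\mathcal{O}_k$ is a $\mathbb{Z}$-basis $\{1,\omega,\theta\}$ with $\omega\theta\in\mathbb{Z}$. $[\beta_1,\beta_2,\beta_3]$ denotes the $\mathbb{Z}$-module generated by $\beta_1,\beta_2,\beta_3$. The conductor of $\mathcal{O}$ is the largest $\mathcal{O}_k$-ideal contained in $\mathcal{O}$, and $N(\mathfrak{f})=(\mathcal{O}_k:\mathfrak{f})$. -}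

module Defs where

open import Data.Nat using (ℕ)
open import Data.Integer using (ℤ; +_; _+_; _*_; -_; _-_; ∣_∣; 0ℤ; 1ℤ)
open import Data.Integer.Divisibility using (_∣_)
import Data.Nat.Divisibility as ℕD
open import Data.Fin using (Fin)
open import Data.Fin.Patterns using (0F; 1F; 2F)
import Data.Fin as F
open import Data.Product using (Σ; ∃; _×_)
open import Relation.Nullary using (yes; no; ¬_)
open import Relation.Binary.PropositionalEquality using (_≡_)

-- We model the étale cubic algebra k as ℚ ⊗ O_k, where O_k is a commutative
-- ring structure on ℤ³ (basis e0 = 1, e1, e2) given by structure constants.
-- Elements of O_k are integer coordinate vectors; every element of k is
-- (1/n)·x for such an x.

V : Set
V = Fin 3 → ℤ

_≋_ : V → V → Set
x ≋ y = ∀ k → x k ≡ y k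

sum3 : (Fin 3 → ℤ) → ℤ
sum3 g = g 0F + g 1F + g 2F

e : Fin 3 → V
e i k with i F.≟ k
... | yes _ = 1ℤ
... | no  _ = 0ℤ

0ᵥ : V
0ᵥ _ = 0ℤ

_+ᵥ_ : V → V → V
(x +ᵥ y) k = x k + y k

-ᵥ_ : V → V
(-ᵥ x) k = - x k

_·ᵥ_ : ℤ → V → V
(n ·ᵥ x) k = n * x k

-- bilinear multiplication from structure constants c i j k
-- (c i j k = coefficient of e k in e i · e j)
mulC : (Fin 3 → Fin 3 → Fin 3 → ℤ) → V → V → V
mulC c x y k = sum3 (λ i → sum3 (λ j → x i * y j * c i j k))

record CubicRing : Set where
  field
    c     : Fin 3 → Fin 3 → Fin 3 → ℤ
    comm  : ∀ i j k → c i j k ≡ c j i k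
    assoc : ∀ i j l → mulC c (mulC c (e i) (e j)) (e l) ≋ mulC c (e i) (mulC c (e j) (e l))
    unit  : ∀ j → mulC c (e 0F) (e j) ≋ e j

  mul : V → V → V
  mul = mulC c

-- Étale over ℚ (characteristic 0): k = ℚ ⊗ R is reduced, i.e. has no nonzero
-- nilpotents; equivalently no nonzero element of square zero (scaling by
-- denominators reduces to integral coordinates).
Reduced : CubicRing → Set
Reduced R = ∀ x → CubicRing.mul R x x ≋ 0ᵥ → x ≋ 0ᵥ

-- R is the maximal order of k: every order S of k containing R equals R.
-- An order containing R has finite index over R, hence lies in (1/n)R for
-- some n ≥ 1; we represent such S by the predicate  S' x  :⇔  (1/n)x ∈ S.
Maximal : CubicRing → Set₁
Maximal R = ∀ (n : ℕ) → ¬ (n ≡ 0) → (S : V → Set)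
  → (∀ x y → x ≋ y → S x → S y)
  → S 0ᵥ
  → (∀ x y → S x → S y → S (x +ᵥ y))
  → (∀ x → S x → S (-ᵥ x))
  → (∀ x → S ((+ n) ·ᵥ x))                                      -- R ⊆ S
  → (∀ x y → S x → S y → ∃ λ z → S z × (CubicRing.mul R x y ≋ ((+ n) ·ᵥ z)))  -- S·S ⊆ S
  → ∀ z → S z → ∀ k → (+ n) ∣ z k                              -- S ⊆ R

Span : (Fin 3 → V) → V → Set
Span b x = ∃ λ (a : Fin 3 → ℤ) → x ≋ (λ k → sum3 (λ i → a i * b i k))

vec3 : V → V → V → Fin 3 → V
vec3 u v w 0F = u
vec3 u v w 1F = v
vec3 u v w 2F = w

det3 : (Fin 3 → V) → ℤ
det3 b =
    b 0F 0F * (b 1F 1F * b 2F 2F - b 1F 2F * b 2F 1F)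
  - b 0F 1F * (b 1F 0F * b 2F 2F - b 1F 2F * b 2F 0F)
  + b 0F 2F * (b 1F 0F * b 2F 1F - b 1F 1F * b 2F 0F)

-- A cubic ring O contained in k with O ⊆ O_k: a full-rank sublattice of O_k
-- (given by a ℤ-basis) containing 1 and closed under multiplication.
record Order (R : CubicRing) : Set where
  field
    basis   : Fin 3 → V
    fullRank : ¬ (det3 basis ≡ 0ℤ)
    hasOne  : Span basis (e 0F)
    mulClosed : ∀ x y → Span basis x → Span basis y → Span basis (CubicRing.mul R x y)

index : {R : CubicRing} → Order R → ℕ
index O = ∣ det3 (Order.basis O) ∣

SquareFree : ℕ → Set
SquareFree f = ∀ p → p Data.Nat.* p ℕD.∣ f → p ≡ 1
  where import Data.Nat

IsIdeal : CubicRing → (V → Set) → Set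
IsIdeal R I =
    (∀ x y → x ≋ y → I x → I y)
  × I 0ᵥ
  × (∀ x y → I x → I y → I (x +ᵥ y))
  × (∀ x → I x → I (-ᵥ x))
  × (∀ r x → I x → I (CubicRing.mul R r x))

_⊆_ : (V → Set) → (V → Set) → Set
P ⊆ Q = ∀ x → P x → Q x

IsConductor : (R : CubicRing) → Order R → (V → Set) → Set₁
IsConductor R O F =
    IsIdeal R F
  × (F ⊆ Span (Order.basis O))
  × (∀ (I : V → Set) → IsIdeal R I → I ⊆ Span (Order.basis O) → I ⊆ F)

module Submission where

--  1. AdaptedBases: a lattice L ⊆ ℤ³ containing 1 with square-free index f has a basis
--     (1, fω₀, θ₀) where (1, ω₀, θ₀) is unimodular.  Hermite reduction makes the basis triangular,
--     (P₀, α, β), (Q₀, 0, δ), (ε, 0, 0); then 1 ∈ L forces ε = ±1, gcd(α, δ)² divides f, so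
--     gcd(α, δ) = 1, and L/ℤ is cyclic.  Only this stage uses square-freeness.
--  2. Normalization: translating ω₀, θ₀ by integers makes ωθ an integer, keeping [1, fω, θ].
--  3. Conductor: in the basis (1, ω, θ) with ω² = A₁ + B₁ω + C₁θ, θ² = A₂ + B₂ω + C₂θ,
--     θ² ∈ O gives f ∣ B₂; associativity gives m = ωθ = C₁B₂ and A₂ = -B₁B₂, so f ∣ m, A₂ and
--     𝔣 is an ideal; an ideal inside O is contained in 𝔣 because multiplication by ω moves the
--     constant coordinate into the ω-coordinate, which is divisible by f in O.

open import Defs
open import Data.Fin using (Fin)
open import Data.Fin.Patterns using (0F; 1F; 2F)
open import Data.Product using (Σ; ∃; _×_; _,_; proj₁; proj₂)
open import Relation.Binary.PropositionalEquality
  using (_≡_; refl; sym; trans; cong; cong₂; subst; module ≡-Reasoning)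
open import Relation.Nullary using (¬_)
open import Data.Integer using (ℤ)

module IntegerFacts where
  open import Data.Nat.Divisibility using (divides)
  import Data.Nat as ℕ
  import Data.Nat.Properties as ℕ
  open import Data.Integer using (ℤ; +_; -[1+_]; ∣_∣; _+_; _*_; -_; _-_; 0ℤ; 1ℤ; -1ℤ)
  import Data.Integer.Properties as ℤ
  open import Data.Integer.Tactic.RingSolver using (solve-∀)
  open import Data.Sum using (inj₁; inj₂)
  open import Data.Empty using (⊥-elim)

  -- To prove  l = r  under the hypothesis  X = 1  it suffices to give the polynomial identity
  -- l = r + K·(X - 1), which the ring solver can check.
  by-unit : ∀ {l r : ℤ} K {X} → X ≡ 1ℤ → l ≡ r + K * (X - 1ℤ) → l ≡ r
  by-unit {l} {r} K X≡1 l≡ = trans l≡ (trans (cong (λ X → r + K * (X - 1ℤ)) X≡1) (cancel r K))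
    where
    cancel : ∀ r K → r + K * (1ℤ - 1ℤ) ≡ r
    cancel = solve-∀

  cancel-nonzero : ∀ a x → a * x ≡ 0ℤ → ¬ x ≡ 0ℤ → a ≡ 0ℤ
  cancel-nonzero a x ax≡0 x≢0 with ℤ.i*j≡0⇒i≡0∨j≡0 a ax≡0
  ... | inj₁ a≡0 = a≡0
  ... | inj₂ x≡0 = ⊥-elim (x≢0 x≡0)

  abs≡1⇒square≡1 : ∀ z → ∣ z ∣ ≡ 1 → z * z ≡ 1ℤ
  abs≡1⇒square≡1 (+ 1)                _  = refl
  abs≡1⇒square≡1 -[1+ 0 ]             _  = refl
  abs≡1⇒square≡1 (+ 0)                ()
  abs≡1⇒square≡1 (+ ℕ.suc (ℕ.suc n))  ()
  abs≡1⇒square≡1 -[1+ ℕ.suc n ]       ()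

  unit⇒abs≡1 : ∀ a z → a * z ≡ 1ℤ → ∣ a ∣ ≡ 1
  unit⇒abs≡1 a z az≡1 = ℕ.m*n≡1⇒m≡1 ∣ a ∣ ∣ z ∣ (trans (sym (ℤ.abs-* a z)) (cong ∣_∣ az≡1))

  unit-square : ∀ a z → a * z ≡ 1ℤ → z * z ≡ 1ℤ
  unit-square a z az≡1 = abs≡1⇒square≡1 z (unit⇒abs≡1 z a (trans (ℤ.*-comm z a) az≡1))

  unit-* : ∀ x y → x * x ≡ 1ℤ → y * y ≡ 1ℤ → (x * y) * (x * y) ≡ 1ℤ
  unit-* x y x²≡1 y²≡1 = begin
    (x * y) * (x * y)   ≡⟨ identity x y ⟩
    (x * x) * (y * y)   ≡⟨ cong₂ _*_ x²≡1 y²≡1 ⟩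
    1ℤ                  ∎
    where
    open ≡-Reasoning
    identity : ∀ x y → (x * y) * (x * y) ≡ (x * x) * (y * y)
    identity = solve-∀

  neg-unit : ∀ x → x * x ≡ 1ℤ → (- x) * (- x) ≡ 1ℤ
  neg-unit x x²≡1 = trans (identity x) x²≡1
    where
    identity : ∀ x → (- x) * (- x) ≡ x * x
    identity = solve-∀

  sign : ∀ z → Σ ℤ λ μ → μ * μ ≡ 1ℤ × + ∣ z ∣ ≡ μ * z
  sign (+ n)    = 1ℤ , refl , sym (ℤ.*-identityˡ (+ n))
  sign -[1+ n ] = -1ℤ , refl , sym (ℤ.-1*i≡-i -[1+ n ])

  abs-up-to-unit : ∀ z α δ ε → ε * ε ≡ 1ℤ → z ≡ α * δ * ε
    → Σ ℤ λ η → η * η ≡ 1ℤ × + ∣ z ∣ ≡ η * (α * δ)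
  abs-up-to-unit z α δ ε ε²≡1 z≡αδε = from-sign (sign z)
    where
    open ≡-Reasoning
    from-sign : (Σ ℤ λ μ → μ * μ ≡ 1ℤ × + ∣ z ∣ ≡ μ * z)
      → Σ ℤ λ η → η * η ≡ 1ℤ × + ∣ z ∣ ≡ η * (α * δ)
    from-sign (μ , μ²≡1 , ∣z∣≡μz) = μ * ε , unit-* μ ε μ²≡1 ε²≡1 , (begin
      + ∣ z ∣           ≡⟨ ∣z∣≡μz ⟩
      μ * z             ≡⟨ cong (μ *_) z≡αδε ⟩
      μ * (α * δ * ε)   ≡⟨ identity μ α δ ε ⟩
      μ * ε * (α * δ)   ∎)
      where
      identity : ∀ μ α δ ε → μ * (α * δ * ε) ≡ μ * ε * (α * δ)
      identity = solve-∀

  squarefree-unit : ∀ z g w → SquareFree ∣ z ∣ → z ≡ g * g * w → g * g ≡ 1ℤ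
  squarefree-unit z g w squarefree z≡g²w =
    abs≡1⇒square≡1 g (squarefree ∣ g ∣ (divides ∣ w ∣ ∣z∣≡∣w∣∣g∣²))
    where
    open ≡-Reasoning
    ∣z∣≡∣w∣∣g∣² : ∣ z ∣ ≡ ∣ w ∣ ℕ.* (∣ g ∣ ℕ.* ∣ g ∣)
    ∣z∣≡∣w∣∣g∣² = begin
      ∣ z ∣                          ≡⟨ cong ∣_∣ z≡g²w ⟩
      ∣ g * g * w ∣                  ≡⟨ ℤ.abs-* (g * g) w ⟩
      ∣ g * g ∣ ℕ.* ∣ w ∣            ≡⟨ cong (ℕ._* ∣ w ∣) (ℤ.abs-* g g) ⟩
      (∣ g ∣ ℕ.* ∣ g ∣) ℕ.* ∣ w ∣    ≡⟨ ℕ.*-comm (∣ g ∣ ℕ.* ∣ g ∣) ∣ w ∣ ⟩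
      ∣ w ∣ ℕ.* (∣ g ∣ ℕ.* ∣ g ∣)    ∎

open IntegerFacts

module Lattices where
  open import Data.Integer using (ℤ; _+_; _*_; -_; 0ℤ; 1ℤ)
  import Data.Integer.Properties as ℤ
  open import Data.Integer.Tactic.RingSolver using (solve-∀)
  open ≡-Reasoning

  all3 : ∀ {ℓ} {P : Fin 3 → Set ℓ} → P 0F → P 1F → P 2F → ∀ j → P j
  all3 p₀ p₁ p₂ 0F = p₀
  all3 p₀ p₁ p₂ 1F = p₁
  all3 p₀ p₁ p₂ 2F = p₂

  v3 : ℤ → ℤ → ℤ → V
  v3 a b c 0F = a
  v3 a b c 1F = b
  v3 a b c 2F = c

  ≋-v3 : ∀ {x y : V} → x 0F ≡ y 0F → x 1F ≡ y 1F → x 2F ≡ y 2F → x ≋ y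
  ≋-v3 h₀ h₁ h₂ = all3 h₀ h₁ h₂

  sum3-cong : {g h : Fin 3 → ℤ} → (∀ i → g i ≡ h i) → sum3 g ≡ sum3 h
  sum3-cong h = cong₂ _+_ (cong₂ _+_ (h 0F) (h 1F)) (h 2F)

  sum3-*ˡ : ∀ w (g : Fin 3 → ℤ) → w * sum3 g ≡ sum3 (λ i → w * g i)
  sum3-*ˡ w g = identity w (g 0F) (g 1F) (g 2F)
    where
    identity : ∀ w a b c → w * (a + b + c) ≡ w * a + w * b + w * c
    identity = solve-∀

  sum3-*ʳ : ∀ (g : Fin 3 → ℤ) w → sum3 g * w ≡ sum3 (λ i → g i * w)
  sum3-*ʳ g w = identity w (g 0F) (g 1F) (g 2F)
    where
    identity : ∀ w a b c → (a + b + c) * w ≡ a * w + b * w + c * w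
    identity = solve-∀

  sum3-+ : ∀ (g h : Fin 3 → ℤ) → sum3 g + sum3 h ≡ sum3 (λ i → g i + h i)
  sum3-+ g h = identity (g 0F) (g 1F) (g 2F) (h 0F) (h 1F) (h 2F)
    where
    identity : ∀ a b c a' b' c' → (a + b + c) + (a' + b' + c') ≡ (a + a') + (b + b') + (c + c')
    identity = solve-∀

  sum3-neg : ∀ (g : Fin 3 → ℤ) → - sum3 g ≡ sum3 (λ i → - g i)
  sum3-neg g = identity (g 0F) (g 1F) (g 2F)
    where
    identity : ∀ a b c → - (a + b + c) ≡ (- a) + (- b) + (- c)
    identity = solve-∀

  sum3-swap : ∀ (h : Fin 3 → Fin 3 → ℤ) → sum3 (λ i → sum3 (h i)) ≡ sum3 (λ j → sum3 (λ i → h i j))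
  sum3-swap h = identity (h 0F 0F) (h 0F 1F) (h 0F 2F) (h 1F 0F) (h 1F 1F) (h 1F 2F) (h 2F 0F) (h 2F 1F) (h 2F 2F)
    where
    identity : ∀ a b c d e f g h i → (a + b + c) + (d + e + f) + (g + h + i) ≡ (a + d + g) + (b + e + h) + (c + f + i)
    identity = solve-∀

  sum3-eˡ : ∀ i (g : Fin 3 → ℤ) → sum3 (λ j → e i j * g j) ≡ g i
  sum3-eˡ 0F g = identity (g 0F) (g 1F) (g 2F)
    where
    identity : ∀ a b c → 1ℤ * a + 0ℤ * b + 0ℤ * c ≡ a
    identity = solve-∀
  sum3-eˡ 1F g = identity (g 0F) (g 1F) (g 2F)
    where
    identity : ∀ a b c → 0ℤ * a + 1ℤ * b + 0ℤ * c ≡ b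
    identity = solve-∀
  sum3-eˡ 2F g = identity (g 0F) (g 1F) (g 2F)
    where
    identity : ∀ a b c → 0ℤ * a + 0ℤ * b + 1ℤ * c ≡ c
    identity = solve-∀

  sum3-eʳ : ∀ (g : Fin 3 → ℤ) k → sum3 (λ j → g j * e j k) ≡ g k
  sum3-eʳ g 0F = identity (g 0F) (g 1F) (g 2F)
    where
    identity : ∀ a b c → a * 1ℤ + b * 0ℤ + c * 0ℤ ≡ a
    identity = solve-∀
  sum3-eʳ g 1F = identity (g 0F) (g 1F) (g 2F)
    where
    identity : ∀ a b c → a * 0ℤ + b * 1ℤ + c * 0ℤ ≡ b
    identity = solve-∀
  sum3-eʳ g 2F = identity (g 0F) (g 1F) (g 2F)
    where
    identity : ∀ a b c → a * 0ℤ + b * 0ℤ + c * 1ℤ ≡ c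
    identity = solve-∀

  comb : (Fin 3 → V) → (Fin 3 → ℤ) → V
  comb b a k = sum3 (λ i → a i * b i k)

  comb-coeff-cong : ∀ b (a a' : Fin 3 → ℤ) → (∀ i → a i ≡ a' i) → comb b a ≋ comb b a'
  comb-coeff-cong b a a' h k = sum3-cong (λ i → cong (_* b i k) (h i))

  comb-standard : ∀ x → x ≋ comb e x
  comb-standard x k = sym (sum3-eʳ x k)

  comb-e : ∀ b j → comb b (e j) ≋ b j
  comb-e b j k = sum3-eˡ j (λ i → b i k)

  comb-+ : ∀ b a a' k → comb b a k + comb b a' k ≡ comb b (λ i → a i + a' i) k
  comb-+ b a a' k = trans (sum3-+ (λ i → a i * b i k) (λ i → a' i * b i k))
                          (sum3-cong (λ i → sym (ℤ.*-distribʳ-+ (b i k) (a i) (a' i))))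

  comb-neg : ∀ b a k → - comb b a k ≡ comb b (λ i → - a i) k
  comb-neg b a k = trans (sum3-neg (λ i → a i * b i k)) (sum3-cong (λ i → ℤ.neg-distribˡ-* (a i) (b i k)))

  comb-scale : ∀ b n a k → n * comb b a k ≡ comb b (λ i → n * a i) k
  comb-scale b n a k = trans (sum3-*ˡ n (λ i → a i * b i k)) (sum3-cong (λ i → sym (ℤ.*-assoc n (a i) (b i k))))

  comb-comb : ∀ b (a : Fin 3 → ℤ) (C : Fin 3 → Fin 3 → ℤ) k
    → sum3 (λ j → a j * comb b (C j) k) ≡ comb b (λ i → sum3 (λ j → a j * C j i)) k
  comb-comb b a C k = begin
    sum3 (λ j → a j * sum3 (λ i → C j i * b i k))        ≡⟨ sum3-cong (λ j → sum3-*ˡ (a j) (λ i → C j i * b i k)) ⟩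
    sum3 (λ j → sum3 (λ i → a j * (C j i * b i k)))      ≡⟨ sum3-swap (λ j i → a j * (C j i * b i k)) ⟩
    sum3 (λ i → sum3 (λ j → a j * (C j i * b i k)))      ≡⟨ sum3-cong (λ i → sum3-cong (λ j → sym (ℤ.*-assoc (a j) (C j i) (b i k)))) ⟩
    sum3 (λ i → sum3 (λ j → a j * C j i * b i k))        ≡⟨ sum3-cong (λ i → sym (sum3-*ʳ (λ j → a j * C j i) (b i k))) ⟩
    sum3 (λ i → sum3 (λ j → a j * C j i) * b i k)        ∎

  span-resp : ∀ b {x y} → x ≋ y → Span b x → Span b y
  span-resp b x≋y (a , h) = a , λ k → trans (sym (x≋y k)) (h k)

  span-gen : ∀ b j → Span b (b j)
  span-gen b j = e j , λ k → sym (comb-e b j k)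

  span-zero : ∀ b → Span b 0ᵥ
  span-zero b = (λ _ → 0ℤ) , λ k → refl

  span-+ : ∀ b {x y} → Span b x → Span b y → Span b (x +ᵥ y)
  span-+ b (a , h) (a' , h') = (λ i → a i + a' i) , λ k → trans (cong₂ _+_ (h k) (h' k)) (comb-+ b a a' k)

  span-neg : ∀ b {x} → Span b x → Span b (-ᵥ x)
  span-neg b (a , h) = (λ i → - a i) , λ k → trans (cong -_ (h k)) (comb-neg b a k)

  span-mono : ∀ b b' → (∀ j → Span b (b' j)) → ∀ {x} → Span b' x → Span b x
  span-mono b b' gens (a , hx) = (λ i → sum3 (λ j → a j * proj₁ (gens j) i)) , λ k →
    trans (hx k) (trans (sum3-cong (λ j → cong (a j *_) (proj₂ (gens j) k)))
                        (comb-comb b a (λ j → proj₁ (gens j)) k))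

  record _≅_ (b b' : Fin 3 → V) : Set where
    constructor mk≅
    field
      to   : ∀ x → Span b x → Span b' x
      from : ∀ x → Span b' x → Span b x

  infix 4 _≅_

  ≅-by-generators : ∀ b b' → (∀ j → Span b (b' j)) → (∀ j → Span b' (b j)) → b ≅ b'
  ≅-by-generators b b' b'⊆b b⊆b' = mk≅ (λ x → span-mono b' b b⊆b') (λ x → span-mono b b' b'⊆b)

  ≅-trans : ∀ {b b' b''} → b ≅ b' → b' ≅ b'' → b ≅ b''
  ≅-trans E E' = mk≅ (λ x s → _≅_.to E' x (_≅_.to E x s)) (λ x s → _≅_.from E x (_≅_.from E' x s))

  ≅-pointwise : ∀ {b b'} → (∀ j → b j ≋ b' j) → b ≅ b'
  ≅-pointwise {b} {b'} h = ≅-by-generators b b'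
    (λ j → span-resp b (h j) (span-gen b j)) (λ j → span-resp b' (λ k → sym (h j k)) (span-gen b' j))

  ≅-vec3 : ∀ b → b ≅ vec3 (b 0F) (b 1F) (b 2F)
  ≅-vec3 b = ≅-pointwise (all3 (λ _ → refl) (λ _ → refl) (λ _ → refl))

  ≅-unit-multiple : ∀ p q r ε → ε * ε ≡ 1ℤ → vec3 p q (ε ·ᵥ r) ≅ vec3 p q r
  ≅-unit-multiple p q r ε ε²≡1 = ≅-by-generators (vec3 p q (ε ·ᵥ r)) (vec3 p q r)
    (all3 (span-gen (vec3 p q (ε ·ᵥ r)) 0F) (span-gen (vec3 p q (ε ·ᵥ r)) 1F)
          (v3 0ℤ 0ℤ ε , λ k → sym (undo-scaling (p k) (q k) (r k))))
    (all3 (span-gen (vec3 p q r) 0F) (span-gen (vec3 p q r) 1F)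
          (v3 0ℤ 0ℤ ε , λ k → scaling (p k) (q k) (r k) ε))
    where
    scaling : ∀ pk qk rk ε → ε * rk ≡ 0ℤ * pk + 0ℤ * qk + ε * rk
    scaling = solve-∀
    undo-scaling : ∀ pk qk rk → 0ℤ * pk + 0ℤ * qk + ε * (ε * rk) ≡ rk
    undo-scaling pk qk rk = begin
      0ℤ * pk + 0ℤ * qk + ε * (ε * rk)  ≡⟨ identity pk qk rk ε ⟩
      ε * ε * rk                        ≡⟨ cong (_* rk) ε²≡1 ⟩
      1ℤ * rk                           ≡⟨ ℤ.*-identityˡ rk ⟩
      rk                                ∎
      where
      identity : ∀ pk qk rk ε → 0ℤ * pk + 0ℤ * qk + ε * (ε * rk) ≡ ε * ε * rk
      identity = solve-∀

open Lattices

module Determinants where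
  open import Data.Integer using (ℤ; _+_; _*_; -_; _-_; 0ℤ; 1ℤ)
  import Data.Integer.Properties as ℤ
  open import Data.Integer.Tactic.RingSolver using (solve-∀)
  open import Data.Sum using (inj₁; inj₂)
  open import Data.Empty using (⊥-elim)

  adj : (Fin 3 → V) → Fin 3 → Fin 3 → ℤ
  adj b 0F 0F = b 1F 1F * b 2F 2F - b 1F 2F * b 2F 1F
  adj b 0F 1F = - (b 1F 0F * b 2F 2F - b 1F 2F * b 2F 0F)
  adj b 0F 2F = b 1F 0F * b 2F 1F - b 1F 1F * b 2F 0F
  adj b 1F 0F = - (b 0F 1F * b 2F 2F - b 0F 2F * b 2F 1F)
  adj b 1F 1F = b 0F 0F * b 2F 2F - b 0F 2F * b 2F 0F
  adj b 1F 2F = - (b 0F 0F * b 2F 1F - b 0F 1F * b 2F 0F)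
  adj b 2F 0F = b 0F 1F * b 1F 2F - b 0F 2F * b 1F 1F
  adj b 2F 1F = - (b 0F 0F * b 1F 2F - b 0F 2F * b 1F 0F)
  adj b 2F 2F = b 0F 0F * b 1F 1F - b 0F 1F * b 1F 0F

  -- Cramer's rule, first half: the coefficients of  x = comb b a  are recovered as
  -- aᵢ · det b = Σₖ adjᵢₖ xₖ  (the polynomial identity adj(B)·B = det(B)·I).
  adj-left : ∀ b (a : Fin 3 → ℤ) i → a i * det3 b ≡ sum3 (λ k → adj b i k * comb b a k)
  adj-left b a 0F = identity (a 0F) (a 1F) (a 2F) (b 0F 0F) (b 0F 1F) (b 0F 2F) (b 1F 0F) (b 1F 1F) (b 1F 2F) (b 2F 0F) (b 2F 1F) (b 2F 2F)
    where
    identity : ∀ a0 a1 a2 b00 b01 b02 b10 b11 b12 b20 b21 b22 →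
      let x0 = a0 * b00 + a1 * b10 + a2 * b20
          x1 = a0 * b01 + a1 * b11 + a2 * b21
          x2 = a0 * b02 + a1 * b12 + a2 * b22
      in a0 * (b00 * (b11 * b22 - b12 * b21) - b01 * (b10 * b22 - b12 * b20) + b02 * (b10 * b21 - b11 * b20))
         ≡ (b11 * b22 - b12 * b21) * x0 + (- (b10 * b22 - b12 * b20)) * x1 + (b10 * b21 - b11 * b20) * x2
    identity = solve-∀
  adj-left b a 1F = identity (a 0F) (a 1F) (a 2F) (b 0F 0F) (b 0F 1F) (b 0F 2F) (b 1F 0F) (b 1F 1F) (b 1F 2F) (b 2F 0F) (b 2F 1F) (b 2F 2F)
    where
    identity : ∀ a0 a1 a2 b00 b01 b02 b10 b11 b12 b20 b21 b22 →
      let x0 = a0 * b00 + a1 * b10 + a2 * b20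
          x1 = a0 * b01 + a1 * b11 + a2 * b21
          x2 = a0 * b02 + a1 * b12 + a2 * b22
      in a1 * (b00 * (b11 * b22 - b12 * b21) - b01 * (b10 * b22 - b12 * b20) + b02 * (b10 * b21 - b11 * b20))
         ≡ (- (b01 * b22 - b02 * b21)) * x0 + (b00 * b22 - b02 * b20) * x1 + (- (b00 * b21 - b01 * b20)) * x2
    identity = solve-∀
  adj-left b a 2F = identity (a 0F) (a 1F) (a 2F) (b 0F 0F) (b 0F 1F) (b 0F 2F) (b 1F 0F) (b 1F 1F) (b 1F 2F) (b 2F 0F) (b 2F 1F) (b 2F 2F)
    where
    identity : ∀ a0 a1 a2 b00 b01 b02 b10 b11 b12 b20 b21 b22 →
      let x0 = a0 * b00 + a1 * b10 + a2 * b20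
          x1 = a0 * b01 + a1 * b11 + a2 * b21
          x2 = a0 * b02 + a1 * b12 + a2 * b22
      in a2 * (b00 * (b11 * b22 - b12 * b21) - b01 * (b10 * b22 - b12 * b20) + b02 * (b10 * b21 - b11 * b20))
         ≡ (b01 * b12 - b02 * b11) * x0 + (- (b00 * b12 - b02 * b10)) * x1 + (b00 * b11 - b01 * b10) * x2
    identity = solve-∀

  -- Cramer's rule, second half: B·adj(B) = det(B)·I, i.e. the coefficients  Σₖ adjᵢₖ xₖ  combine
  -- the rows of b to  det b · x.
  adj-right : ∀ b (x : V) k → comb b (λ i → sum3 (λ k' → adj b i k' * x k')) k ≡ det3 b * x k
  adj-right b x 0F = identity (x 0F) (x 1F) (x 2F) (b 0F 0F) (b 0F 1F) (b 0F 2F) (b 1F 0F) (b 1F 1F) (b 1F 2F) (b 2F 0F) (b 2F 1F) (b 2F 2F)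
    where
    identity : ∀ x0 x1 x2 b00 b01 b02 b10 b11 b12 b20 b21 b22 →
      let y0 = (b11 * b22 - b12 * b21) * x0 + (- (b10 * b22 - b12 * b20)) * x1 + (b10 * b21 - b11 * b20) * x2
          y1 = (- (b01 * b22 - b02 * b21)) * x0 + (b00 * b22 - b02 * b20) * x1 + (- (b00 * b21 - b01 * b20)) * x2
          y2 = (b01 * b12 - b02 * b11) * x0 + (- (b00 * b12 - b02 * b10)) * x1 + (b00 * b11 - b01 * b10) * x2
      in y0 * b00 + y1 * b10 + y2 * b20 ≡ (b00 * (b11 * b22 - b12 * b21) - b01 * (b10 * b22 - b12 * b20) + b02 * (b10 * b21 - b11 * b20)) * x0
    identity = solve-∀
  adj-right b x 1F = identity (x 0F) (x 1F) (x 2F) (b 0F 0F) (b 0F 1F) (b 0F 2F) (b 1F 0F) (b 1F 1F) (b 1F 2F) (b 2F 0F) (b 2F 1F) (b 2F 2F)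
    where
    identity : ∀ x0 x1 x2 b00 b01 b02 b10 b11 b12 b20 b21 b22 →
      let y0 = (b11 * b22 - b12 * b21) * x0 + (- (b10 * b22 - b12 * b20)) * x1 + (b10 * b21 - b11 * b20) * x2
          y1 = (- (b01 * b22 - b02 * b21)) * x0 + (b00 * b22 - b02 * b20) * x1 + (- (b00 * b21 - b01 * b20)) * x2
          y2 = (b01 * b12 - b02 * b11) * x0 + (- (b00 * b12 - b02 * b10)) * x1 + (b00 * b11 - b01 * b10) * x2
      in y0 * b01 + y1 * b11 + y2 * b21 ≡ (b00 * (b11 * b22 - b12 * b21) - b01 * (b10 * b22 - b12 * b20) + b02 * (b10 * b21 - b11 * b20)) * x1
    identity = solve-∀
  adj-right b x 2F = identity (x 0F) (x 1F) (x 2F) (b 0F 0F) (b 0F 1F) (b 0F 2F) (b 1F 0F) (b 1F 1F) (b 1F 2F) (b 2F 0F) (b 2F 1F) (b 2F 2F)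
    where
    identity : ∀ x0 x1 x2 b00 b01 b02 b10 b11 b12 b20 b21 b22 →
      let y0 = (b11 * b22 - b12 * b21) * x0 + (- (b10 * b22 - b12 * b20)) * x1 + (b10 * b21 - b11 * b20) * x2
          y1 = (- (b01 * b22 - b02 * b21)) * x0 + (b00 * b22 - b02 * b20) * x1 + (- (b00 * b21 - b01 * b20)) * x2
          y2 = (b01 * b12 - b02 * b11) * x0 + (- (b00 * b12 - b02 * b10)) * x1 + (b00 * b11 - b01 * b10) * x2
      in y0 * b02 + y1 * b12 + y2 * b22 ≡ (b00 * (b11 * b22 - b12 * b21) - b01 * (b10 * b22 - b12 * b20) + b02 * (b10 * b21 - b11 * b20)) * x2
    identity = solve-∀

  comb-injective : ∀ b (a : Fin 3 → ℤ) → ¬ det3 b ≡ 0ℤ → (∀ k → comb b a k ≡ 0ℤ) → ∀ i → a i ≡ 0ℤ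
  comb-injective b a det≢0 a↦0 i with ℤ.i*j≡0⇒i≡0∨j≡0 (a i) aᵢdet≡0
    where
    aᵢdet≡0 : a i * det3 b ≡ 0ℤ
    aᵢdet≡0 = trans (adj-left b a i) (sum3-cong (λ k → trans (cong (adj b i k *_) (a↦0 k)) (ℤ.*-zeroʳ (adj b i k))))
  ... | inj₁ aᵢ≡0  = aᵢ≡0
  ... | inj₂ det≡0 = ⊥-elim (det≢0 det≡0)

  coords-unique : ∀ b {x} (a a' : Fin 3 → ℤ) → ¬ det3 b ≡ 0ℤ → x ≋ comb b a → x ≋ comb b a' → ∀ i → a i ≡ a' i
  coords-unique b {x} a a' det≢0 x≋a x≋a' i =
    ℤ.i-j≡0⇒i≡j (a i) (a' i) (comb-injective b (λ i → a i - a' i) det≢0 difference i)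
    where
    open ≡-Reasoning
    difference : ∀ k → comb b (λ i → a i - a' i) k ≡ 0ℤ
    difference k = begin
      comb b (λ i → a i - a' i) k             ≡⟨ sym (comb-+ b a (λ i → - a' i) k) ⟩
      comb b a k + comb b (λ i → - a' i) k    ≡⟨ cong (comb b a k +_) (sym (comb-neg b a' k)) ⟩
      comb b a k - comb b a' k                ≡⟨ cong₂ _-_ (sym (x≋a k)) (sym (x≋a' k)) ⟩
      x k - x k                               ≡⟨ ℤ.+-inverseʳ (x k) ⟩
      0ℤ                                      ∎

  Unimodular : (Fin 3 → V) → Set
  Unimodular b = Σ ℤ λ d → det3 b * d ≡ 1ℤ

  -- A unimodular triple is a ℤ-basis of ℤ³: by Cramer's rule every x lies in its span.
  unimodular-spans : ∀ b → Unimodular b → ∀ x → Span b x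
  unimodular-spans b (d , unimodular) x = coefficients , λ k → sym (expansion k)
    where
    open ≡-Reasoning
    cramer : Fin 3 → ℤ
    cramer i = sum3 (λ k → adj b i k * x k)
    coefficients : Fin 3 → ℤ
    coefficients i = d * cramer i
    expansion : ∀ k → comb b coefficients k ≡ x k
    expansion k = begin
      comb b coefficients k    ≡⟨ sym (comb-scale b d cramer k) ⟩
      d * comb b cramer k      ≡⟨ cong (d *_) (adj-right b x k) ⟩
      d * (det3 b * x k)       ≡⟨ sym (ℤ.*-assoc d (det3 b) (x k)) ⟩
      d * det3 b * x k         ≡⟨ cong (_* x k) (trans (ℤ.*-comm d (det3 b)) unimodular) ⟩
      1ℤ * x k                 ≡⟨ ℤ.*-identityˡ (x k) ⟩
      x k                      ∎

  det-triangular : ∀ (P Q R : V) → Q 1F ≡ 0ℤ → R 1F ≡ 0ℤ → R 2F ≡ 0ℤ → det3 (vec3 P Q R) ≡ P 1F * Q 2F * R 0F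
  det-triangular P Q R = identity (P 0F) (P 1F) (P 2F) (Q 0F) (Q 1F) (Q 2F) (R 0F) (R 1F) (R 2F)
    where
    identity : ∀ p0 p1 p2 q0 q1 q2 r0 r1 r2 → q1 ≡ 0ℤ → r1 ≡ 0ℤ → r2 ≡ 0ℤ
      → p0 * (q1 * r2 - q2 * r1) - p1 * (q0 * r2 - q2 * r0) + p2 * (q0 * r1 - q1 * r0) ≡ p1 * q2 * r0
    identity p0 p1 p2 q0 .0ℤ q2 r0 .0ℤ .0ℤ refl refl refl = polynomial p0 p1 p2 q0 q2 r0
      where
      polynomial : ∀ p0 p1 p2 q0 q2 r0
        → p0 * (0ℤ * 0ℤ - q2 * 0ℤ) - p1 * (q0 * 0ℤ - q2 * r0) + p2 * (q0 * 0ℤ - 0ℤ * r0) ≡ p1 * q2 * r0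
      polynomial = solve-∀

  det-e₀ : ∀ (w t : V) → det3 (vec3 (e 0F) w t) ≡ w 1F * t 2F - w 2F * t 1F
  det-e₀ w t = identity (w 0F) (w 1F) (w 2F) (t 0F) (t 1F) (t 2F)
    where
    identity : ∀ w0 w1 w2 t0 t1 t2 → 1ℤ * (w1 * t2 - w2 * t1) - 0ℤ * (w0 * t2 - w2 * t0) + 0ℤ * (w0 * t1 - w1 * t0) ≡ w1 * t2 - w2 * t1
    identity = solve-∀

  det-shear : ∀ (p q r : V) s t → det3 (vec3 p (comb (vec3 p q r) (v3 s 1ℤ 0ℤ)) (comb (vec3 p q r) (v3 t 0ℤ 1ℤ))) ≡ det3 (vec3 p q r)
  det-shear p q r s t = identity (p 0F) (p 1F) (p 2F) (q 0F) (q 1F) (q 2F) (r 0F) (r 1F) (r 2F) s t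
    where
    identity : ∀ p0 p1 p2 q0 q1 q2 r0 r1 r2 s t →
      let w0 = s * p0 + 1ℤ * q0 + 0ℤ * r0
          w1 = s * p1 + 1ℤ * q1 + 0ℤ * r1
          w2 = s * p2 + 1ℤ * q2 + 0ℤ * r2
          u0 = t * p0 + 0ℤ * q0 + 1ℤ * r0
          u1 = t * p1 + 0ℤ * q1 + 1ℤ * r1
          u2 = t * p2 + 0ℤ * q2 + 1ℤ * r2
      in p0 * (w1 * u2 - w2 * u1) - p1 * (w0 * u2 - w2 * u0) + p2 * (w0 * u1 - w1 * u0)
         ≡ p0 * (q1 * r2 - q2 * r1) - p1 * (q0 * r2 - q2 * r0) + p2 * (q0 * r1 - q1 * r0)
    identity = solve-∀

  det-scale : ∀ (f : ℤ) (p q r : V) → det3 (vec3 (f ·ᵥ p) (f ·ᵥ q) r) ≡ f * f * det3 (vec3 p q r)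
  det-scale f p q r = identity f (p 0F) (p 1F) (p 2F) (q 0F) (q 1F) (q 2F) (r 0F) (r 1F) (r 2F)
    where
    identity : ∀ f p0 p1 p2 q0 q1 q2 r0 r1 r2 →
        f * p0 * (f * q1 * r2 - f * q2 * r1) - f * p1 * (f * q0 * r2 - f * q2 * r0) + f * p2 * (f * q0 * r1 - f * q1 * r0)
      ≡ f * f * (p0 * (q1 * r2 - q2 * r1) - p1 * (q0 * r2 - q2 * r0) + p2 * (q0 * r1 - q1 * r0))
    identity = solve-∀

open Determinants

module HermiteReduction where
  open import Data.Nat using (_<_)
  open import Data.Nat.Induction using (<-wellFounded)
  open import Induction.WellFounded using (Acc; acc)
  open import Data.Integer using (ℤ; +_; +[1+_]; -[1+_]; ∣_∣; _+_; _*_; -_; _-_; 0ℤ; 1ℤ)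
  open import Data.Integer.DivMod using (_/_; _%_; a≡a%n+[a/n]*n; n%d<d)
  import Data.Integer.Properties as ℤ
  open import Data.Integer.Tactic.RingSolver using (solve-∀)

  record Bezout (a b : ℤ) : Set where
    constructor bezout
    field
      g u v s t : ℤ
      a≡gu      : a ≡ g * u
      b≡gv      : b ≡ g * v
      su+tv≡1   : s * u + t * v ≡ 1ℤ

  bezout-zero : ∀ a → Bezout a 0ℤ
  bezout-zero a = bezout a 1ℤ 0ℤ 1ℤ 0ℤ (sym (ℤ.*-identityʳ a)) (sym (ℤ.*-zeroʳ a)) refl

  bezout-step : ∀ {a b} q r → a ≡ r + q * b → Bezout b r → Bezout a b
  bezout-step {a} q r a≡r+qb (bezout g u v s t b≡gu r≡gv su+tv≡1) =
    bezout g (v + q * u) u t (s - t * q) a≡g[v+qu] b≡gu (trans (cofactors s t u v q) su+tv≡1)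
    where
    divisor : ∀ g u v q → g * v + q * (g * u) ≡ g * (v + q * u)
    divisor = solve-∀
    cofactors : ∀ s t u v q → t * (v + q * u) + (s - t * q) * u ≡ s * u + t * v
    cofactors = solve-∀
    a≡g[v+qu] : a ≡ g * (v + q * u)
    a≡g[v+qu] = trans a≡r+qb (trans (cong₂ (λ r' b' → r' + q * b') r≡gv b≡gu) (divisor g u v q))

  euclid : ∀ a b → Acc _<_ ∣ b ∣ → Bezout a b
  euclid a (+ 0)          _             = bezout-zero a
  euclid a b@(+[1+ _ ])   (acc smaller) =
    bezout-step (a / b) (+ (a % b)) (a≡a%n+[a/n]*n a b) (euclid b (+ (a % b)) (smaller (n%d<d a b)))
  euclid a b@(-[1+ _ ])   (acc smaller) =
    bezout-step (a / b) (+ (a % b)) (a≡a%n+[a/n]*n a b) (euclid b (+ (a % b)) (smaller (n%d<d a b)))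

  bezout-ℤ : ∀ a b → Bezout a b
  bezout-ℤ a b = euclid a b (<-wellFounded ∣ b ∣)

  lin : ℤ → ℤ → V → V → V
  lin s t p q j = s * p j + t * q j

  lin-zero : ∀ s t (p q : V) j → p j ≡ 0ℤ → q j ≡ 0ℤ → lin s t p q j ≡ 0ℤ
  lin-zero s t p q j pj≡0 qj≡0 = trans (cong₂ (λ x y → s * x + t * y) pj≡0 qj≡0) (identity s t)
    where
    identity : ∀ s t → s * 0ℤ + t * 0ℤ ≡ 0ℤ
    identity = solve-∀

  -- Replacing rows p, q by  s p + t q  and  -v p + u q  is a change of basis of determinant
  -- s u + t v = 1: it changes neither the lattice nor the determinant.
  module RowOperation (s t u v : ℤ) (su+tv≡1 : s * u + t * v ≡ 1ℤ) (p q r : V) where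
    P′ Q′ : V
    P′ = lin s t p q
    Q′ = lin (- v) u p q

    same-lattice : vec3 p q r ≅ vec3 P′ Q′ r
    same-lattice = ≅-by-generators (vec3 p q r) (vec3 P′ Q′ r)
      (all3 (v3 s t 0ℤ , λ j → new-row s t (p j) (q j) (r j))
            (v3 (- v) u 0ℤ , λ j → new-row (- v) u (p j) (q j) (r j))
            (span-gen (vec3 p q r) 2F))
      (all3 (v3 u (- t) 0ℤ , λ j → old-row (old-p s t u v (p j) (q j) (r j)))
            (v3 v s 0ℤ , λ j → old-row (old-q s t u v (p j) (q j) (r j)))
            (span-gen (vec3 P′ Q′ r) 2F))
      where
      new-row : ∀ s t pj qj rj → s * pj + t * qj ≡ s * pj + t * qj + 0ℤ * rj
      new-row = solve-∀
      old-p : ∀ s t u v pj qj rj → u * (s * pj + t * qj) + (- t) * ((- v) * pj + u * qj) + 0ℤ * rj ≡ (s * u + t * v) * pj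
      old-p = solve-∀
      old-q : ∀ s t u v pj qj rj → v * (s * pj + t * qj) + s * ((- v) * pj + u * qj) + 0ℤ * rj ≡ (s * u + t * v) * qj
      old-q = solve-∀
      old-row : ∀ {x y} → y ≡ (s * u + t * v) * x → x ≡ y
      old-row {x} y≡ = sym (trans y≡ (trans (cong (_* x) su+tv≡1) (ℤ.*-identityˡ x)))

    same-det : det3 (vec3 P′ Q′ r) ≡ det3 (vec3 p q r)
    same-det = trans (identity (p 0F) (p 1F) (p 2F) (q 0F) (q 1F) (q 2F) (r 0F) (r 1F) (r 2F) s t u v)
                     (trans (cong (_* det3 (vec3 p q r)) su+tv≡1) (ℤ.*-identityˡ _))
      where
      identity : ∀ p0 p1 p2 q0 q1 q2 r0 r1 r2 s t u v →
          (s * p0 + t * q0) * (((- v) * p1 + u * q1) * r2 - ((- v) * p2 + u * q2) * r1)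
        - (s * p1 + t * q1) * (((- v) * p0 + u * q0) * r2 - ((- v) * p2 + u * q2) * r0)
        + (s * p2 + t * q2) * (((- v) * p0 + u * q0) * r1 - ((- v) * p1 + u * q1) * r0)
        ≡ (s * u + t * v) * (p0 * (q1 * r2 - q2 * r1) - p1 * (q0 * r2 - q2 * r0) + p2 * (q0 * r1 - q1 * r0))
      identity = solve-∀

  record Elimination (p q r : V) (k : Fin 3) : Set where
    field
      p′ q′        : V
      same-lattice : vec3 p q r ≅ vec3 p′ q′ r
      same-det     : det3 (vec3 p′ q′ r) ≡ det3 (vec3 p q r)
      clears       : q′ k ≡ 0ℤ
      keeps-zeros  : ∀ j → p j ≡ 0ℤ → q j ≡ 0ℤ → p′ j ≡ 0ℤ × q′ j ≡ 0ℤ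

  eliminate : ∀ p q r k → Elimination p q r k
  eliminate p q r k = record
    { p′ = P′ ; q′ = Q′ ; same-lattice = same-lattice ; same-det = same-det
    ; clears = trans (cong₂ (λ x y → (- v) * x + u * y) a≡gu b≡gv) (cancel g u v)
    ; keeps-zeros = λ j pj≡0 qj≡0 → lin-zero s t p q j pj≡0 qj≡0 , lin-zero (- v) u p q j pj≡0 qj≡0 }
    where
    open Bezout (bezout-ℤ (p k) (q k))
    open RowOperation s t u v su+tv≡1 p q r
    cancel : ∀ g u v → (- v) * (g * u) + u * (g * v) ≡ 0ℤ
    cancel = solve-∀

  ≅-rotate : ∀ p q r → vec3 p q r ≅ vec3 q r p
  ≅-rotate p q r = ≅-by-generators (vec3 p q r) (vec3 q r p)
    (all3 (span-gen (vec3 p q r) 1F) (span-gen (vec3 p q r) 2F) (span-gen (vec3 p q r) 0F))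
    (all3 (span-gen (vec3 q r p) 2F) (span-gen (vec3 q r p) 0F) (span-gen (vec3 q r p) 1F))

  det-rotate : ∀ p q r → det3 (vec3 q r p) ≡ det3 (vec3 p q r)
  det-rotate p q r = identity (p 0F) (p 1F) (p 2F) (q 0F) (q 1F) (q 2F) (r 0F) (r 1F) (r 2F)
    where
    identity : ∀ p0 p1 p2 q0 q1 q2 r0 r1 r2 → q0 * (r1 * p2 - r2 * p1) - q1 * (r0 * p2 - r2 * p0) + q2 * (r0 * p1 - r1 * p0)
                                              ≡ p0 * (q1 * r2 - q2 * r1) - p1 * (q0 * r2 - q2 * r0) + p2 * (q0 * r1 - q1 * r0)
    identity = solve-∀

  record Triangular (b : Fin 3 → V) : Set where
    field
      P Q R        : V
      same-lattice : b ≅ vec3 P Q R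
      same-det     : det3 (vec3 P Q R) ≡ det3 b
      Q₁≡0         : Q 1F ≡ 0ℤ
      R₁≡0         : R 1F ≡ 0ℤ
      R₂≡0         : R 2F ≡ 0ℤ

  triangularize : ∀ b → Triangular b
  triangularize b = record
    { P = P ; Q = Q ; R = R
    ; same-lattice = ≅-trans (≅-vec3 b) (≅-trans (E.same-lattice E₁)
        (≅-trans (≅-rotate r₀ r₁ (b 2F)) (≅-trans (≅-rotate r₁ (b 2F) r₀) (≅-trans (E.same-lattice E₂)
        (≅-trans (≅-rotate P s₂ r₁) (≅-trans (E.same-lattice E₃)
        (≅-trans (≅-rotate Q R P) (≅-rotate R P Q))))))))
    ; same-det = begin
        det3 (vec3 P Q R)        ≡⟨ det-rotate R P Q ⟩
        det3 (vec3 R P Q)        ≡⟨ det-rotate Q R P ⟩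
        det3 (vec3 Q R P)        ≡⟨ E.same-det E₃ ⟩
        det3 (vec3 s₂ r₁ P)      ≡⟨ det-rotate P s₂ r₁ ⟩
        det3 (vec3 P s₂ r₁)      ≡⟨ E.same-det E₂ ⟩
        det3 (vec3 (b 2F) r₀ r₁) ≡⟨ det-rotate r₁ (b 2F) r₀ ⟩
        det3 (vec3 r₁ (b 2F) r₀) ≡⟨ det-rotate r₀ r₁ (b 2F) ⟩
        det3 (vec3 r₀ r₁ (b 2F)) ≡⟨ E.same-det E₁ ⟩
        det3 b                   ∎
    ; Q₁≡0 = proj₁ (E.keeps-zeros E₃ 1F (E.clears E₂) (E.clears E₁))
    ; R₁≡0 = proj₂ (E.keeps-zeros E₃ 1F (E.clears E₂) (E.clears E₁))
    ; R₂≡0 = E.clears E₃ }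
    where
    open ≡-Reasoning
    module E = Elimination
    -- E₁ clears coordinate 1 of one row, E₂ (after a rotation) that of a second row, and E₃
    -- coordinate 2 of the second of these, keeping the zeros already created in coordinate 1.
    E₁ : Elimination (b 0F) (b 1F) (b 2F) 1F
    E₁ = eliminate (b 0F) (b 1F) (b 2F) 1F
    r₀ r₁ : V
    r₀ = E.p′ E₁
    r₁ = E.q′ E₁
    E₂ : Elimination (b 2F) r₀ r₁ 1F
    E₂ = eliminate (b 2F) r₀ r₁ 1F
    P s₂ : V
    P  = E.p′ E₂
    s₂ = E.q′ E₂
    E₃ : Elimination s₂ r₁ P 2F
    E₃ = eliminate s₂ r₁ P 2F
    Q R : V
    Q  = E.p′ E₃
    R  = E.q′ E₃

open HermiteReduction

module AdaptedBases where
  open import Data.Integer using (ℤ; +_; ∣_∣; _+_; _*_; -_; _-_; 0ℤ; 1ℤ)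
  import Data.Integer.Properties as ℤ
  open import Data.Integer.Tactic.RingSolver using (solve-∀)

  -- If αδw has square-free absolute value, then gcd(α, δ)² divides it, so α and δ are coprime.
  squarefree-coprime : ∀ α δ w → SquareFree ∣ α * δ * w ∣ → Σ ℤ λ σ → Σ ℤ λ τ → σ * α + τ * δ ≡ 1ℤ
  squarefree-coprime α δ w squarefree = g * s , g * t , (begin
    g * s * α + g * t * δ                   ≡⟨ cong₂ (λ x y → g * s * x + g * t * y) a≡gu b≡gv ⟩
    g * s * (g * u) + g * t * (g * v)       ≡⟨ regroup g s t u v ⟩
    g * g * (s * u + t * v)                 ≡⟨ cong₂ _*_ g²≡1 su+tv≡1 ⟩
    1ℤ                                      ∎)
    where
    open ≡-Reasoning
    open Bezout (bezout-ℤ α δ)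
    factor : ∀ g u v w → g * u * (g * v) * w ≡ g * g * (u * v * w)
    factor = solve-∀
    regroup : ∀ g s t u v → g * s * (g * u) + g * t * (g * v) ≡ g * g * (s * u + t * v)
    regroup = solve-∀
    g²≡1 : g * g ≡ 1ℤ
    g²≡1 = squarefree-unit (α * δ * w) g (u * v * w) squarefree
             (trans (cong₂ (λ x y → x * y * w) a≡gu b≡gv) (factor g u v w))

  e₀-forces-unit : ∀ P0 α β Q0 δ ε → ¬ α * δ * ε ≡ 0ℤ
    → Span (vec3 (v3 P0 α β) (v3 Q0 0ℤ δ) (v3 ε 0ℤ 0ℤ)) (e 0F) → ε * ε ≡ 1ℤ
  e₀-forces-unit P0 α β Q0 δ ε nondegenerate (a , e₀≋) = unit-square (a 2F) ε a₂ε≡1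
    where
    α≢0 : ¬ α ≡ 0ℤ
    α≢0 α≡0 = nondegenerate (cong (λ x → x * δ * ε) α≡0)
    δ≢0 : ¬ δ ≡ 0ℤ
    δ≢0 δ≡0 = nondegenerate (trans (cong (λ x → α * x * ε) δ≡0) (cong (_* ε) (ℤ.*-zeroʳ α)))
    coordinate₁ : ∀ a0 a1 a2 α → a0 * α + a1 * 0ℤ + a2 * 0ℤ ≡ a0 * α
    coordinate₁ = solve-∀
    coordinate₂ : ∀ a1 a2 β δ → 0ℤ * β + a1 * δ + a2 * 0ℤ ≡ a1 * δ
    coordinate₂ = solve-∀
    a₀≡0 : a 0F ≡ 0ℤ
    a₀≡0 = cancel-nonzero (a 0F) α (sym (trans (e₀≋ 1F) (coordinate₁ (a 0F) (a 1F) (a 2F) α))) α≢0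
    a₁≡0 : a 1F ≡ 0ℤ
    a₁≡0 = cancel-nonzero (a 1F) δ (sym (trans (e₀≋ 2F)
      (trans (cong (λ x → x * β + a 1F * δ + a 2F * 0ℤ) a₀≡0) (coordinate₂ (a 1F) (a 2F) β δ)))) δ≢0
    coordinate₀ : ∀ a0 a1 a2 → a0 ≡ 0ℤ → a1 ≡ 0ℤ → a0 * P0 + a1 * Q0 + a2 * ε ≡ a2 * ε
    coordinate₀ .0ℤ .0ℤ a2 refl refl = ℤ.+-identityˡ (a2 * ε)
    a₂ε≡1 : a 2F * ε ≡ 1ℤ
    a₂ε≡1 = sym (trans (e₀≋ 0F) (coordinate₀ (a 0F) (a 1F) (a 2F) a₀≡0 a₁≡0))

  -- If gcd(α, δ) = 1 (witnessed by σα + τδ = 1), the lattice spanned by 1, (P0, α, β), (Q0, 0, δ)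
  -- has the basis 1, W = (0, -αδ, -αδr), T = (0, α, γ) with γ - αr = 1: modulo ℤ·1 it is
  -- cyclic, generated by T, and W spans its intersection with the line through (0, 1, r).
  module CyclicBasis (P0 α β Q0 δ σ τ : ℤ) (σα+τδ≡1 : σ * α + τ * δ ≡ 1ℤ) where
    t r γ : ℤ
    t = (1ℤ - β) * τ
    r = - ((1ℤ - β) * σ)
    γ = β + δ * t

    γ-αr≡1 : γ - α * r ≡ 1ℤ
    γ-αr≡1 = by-unit (1ℤ - β) σα+τδ≡1 (identity α β δ σ τ)
      where
      identity : ∀ α β δ σ τ → (β + δ * ((1ℤ - β) * τ)) - α * (- ((1ℤ - β) * σ))
                               ≡ 1ℤ + (1ℤ - β) * ((σ * α + τ * δ) - 1ℤ)
      identity = solve-∀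

    W T : V
    W = v3 0ℤ (- (α * δ)) (- (α * δ * r))
    T = v3 0ℤ α γ

    same-lattice : vec3 (v3 P0 α β) (v3 Q0 0ℤ δ) (e 0F) ≅ vec3 (e 0F) W T
    same-lattice = ≅-by-generators (vec3 (v3 P0 α β) (v3 Q0 0ℤ δ) (e 0F)) (vec3 (e 0F) W T)
      (all3 (span-gen (vec3 (v3 P0 α β) (v3 Q0 0ℤ δ) (e 0F)) 2F)
            (v3 (- δ) (β - α * r) (δ * P0 - (β - α * r) * Q0) ,
               ≋-v3 (W₀ δ P0 β α r Q0) (W₁ δ α β r (δ * P0 - (β - α * r) * Q0)) (W₂ δ α β r (δ * P0 - (β - α * r) * Q0)))
            (v3 1ℤ t (- (P0 + t * Q0)) ,
               ≋-v3 (T₀ P0 t Q0) (T₁ α t (- (P0 + t * Q0))) (T₂ β δ t (- (P0 + t * Q0)))))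
      (all3 (v3 P0 (- t) (1ℤ - t * δ) ,
               ≋-v3 (P₀ P0 t δ) (P₁ P0 t δ α) (by-unit (t * δ) γ-αr≡1 (P₂ P0 t δ α β r)))
            (v3 Q0 1ℤ δ ,
               ≋-v3 (Q₀ Q0 δ) (Q₁ Q0 α δ) (by-unit (- δ) γ-αr≡1 (Q₂ Q0 α δ β t r)))
            (span-gen (vec3 (e 0F) W T) 0F))
      where
      W₀ : ∀ δ P0 β α r Q0 → 0ℤ ≡ (- δ) * P0 + (β - α * r) * Q0 + (δ * P0 - (β - α * r) * Q0) * 1ℤ
      W₀ = solve-∀
      W₁ : ∀ δ α β r c → - (α * δ) ≡ (- δ) * α + (β - α * r) * 0ℤ + c * 0ℤ
      W₁ = solve-∀
      W₂ : ∀ δ α β r c → - (α * δ * r) ≡ (- δ) * β + (β - α * r) * δ + c * 0ℤ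
      W₂ = solve-∀
      T₀ : ∀ P0 t Q0 → 0ℤ ≡ 1ℤ * P0 + t * Q0 + (- (P0 + t * Q0)) * 1ℤ
      T₀ = solve-∀
      T₁ : ∀ α t c → α ≡ 1ℤ * α + t * 0ℤ + c * 0ℤ
      T₁ = solve-∀
      T₂ : ∀ β δ t c → β + δ * t ≡ 1ℤ * β + t * δ + c * 0ℤ
      T₂ = solve-∀
      P₀ : ∀ P0 t δ → P0 ≡ P0 * 1ℤ + (- t) * 0ℤ + (1ℤ - t * δ) * 0ℤ
      P₀ = solve-∀
      P₁ : ∀ P0 t δ α → α ≡ P0 * 0ℤ + (- t) * (- (α * δ)) + (1ℤ - t * δ) * α
      P₁ = solve-∀
      P₂ : ∀ P0 t δ α β r → β ≡ P0 * 0ℤ + (- t) * (- (α * δ * r)) + (1ℤ - t * δ) * (β + δ * t)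
                                 + t * δ * (((β + δ * t) - α * r) - 1ℤ)
      P₂ = solve-∀
      Q₀ : ∀ Q0 δ → Q0 ≡ Q0 * 1ℤ + 1ℤ * 0ℤ + δ * 0ℤ
      Q₀ = solve-∀
      Q₁ : ∀ Q0 α δ → 0ℤ ≡ Q0 * 0ℤ + 1ℤ * (- (α * δ)) + δ * α
      Q₁ = solve-∀
      Q₂ : ∀ Q0 α δ β t r → δ ≡ Q0 * 0ℤ + 1ℤ * (- (α * δ * r)) + δ * (β + δ * t)
                               + (- δ) * (((β + δ * t) - α * r) - 1ℤ)
      Q₂ = solve-∀

    ω₀ : ℤ → V
    ω₀ η = v3 0ℤ (- η) (- (η * r))

    W≋fω₀ : ∀ f η → η * η ≡ 1ℤ → f ≡ η * (α * δ) → W ≋ (f ·ᵥ ω₀ η)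
    W≋fω₀ .(η * (α * δ)) η η²≡1 refl = ≋-v3
      (sym (ℤ.*-zeroʳ (η * (α * δ))))
      (by-unit (α * δ) η²≡1 (coordinate₁ α δ η))
      (by-unit (α * δ * r) η²≡1 (coordinate₂ α δ η r))
      where
      coordinate₁ : ∀ α δ η → - (α * δ) ≡ η * (α * δ) * (- η) + α * δ * (η * η - 1ℤ)
      coordinate₁ = solve-∀
      coordinate₂ : ∀ α δ η r → - (α * δ * r) ≡ η * (α * δ) * (- (η * r)) + α * δ * r * (η * η - 1ℤ)
      coordinate₂ = solve-∀

    det-ω₀ : ∀ η → det3 (vec3 (e 0F) (ω₀ η) T) ≡ - η
    det-ω₀ η = trans (det-e₀ (ω₀ η) T) (by-unit (- η) γ-αr≡1 (minor η α r (β + δ * t)))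
      where
      minor : ∀ η α r γ → (- η) * γ - (- (η * r)) * α ≡ - η + (- η) * ((γ - α * r) - 1ℤ)
      minor = solve-∀

  record AdaptedBasis (b : Fin 3 → V) (f : ℤ) : Set where
    field
      ω₀ θ₀        : V
      unimodular   : Unimodular (vec3 (e 0F) ω₀ θ₀)
      same-lattice : b ≅ vec3 (e 0F) (f ·ᵥ ω₀) θ₀

  adapted-basis : ∀ b → ¬ det3 b ≡ 0ℤ → Span b (e 0F) → SquareFree ∣ det3 b ∣ → AdaptedBasis b (+ ∣ det3 b ∣)
  adapted-basis b det≢0 e₀∈b squarefree = record
    { ω₀ = ω₀ η ; θ₀ = T ; unimodular = - η , trans (cong (_* (- η)) (det-ω₀ η)) (neg-unit η η²≡1)
    ; same-lattice = adapted }
    where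
    open Triangular (triangularize b) renaming (same-lattice to triangularized)
    P0 α β Q0 δ ε : ℤ
    P0 = P 0F
    α  = P 1F
    β  = P 2F
    Q0 = Q 0F
    δ  = Q 2F
    ε  = R 0F
    P̃ Q̃ R̃ : V
    P̃ = v3 P0 α β
    Q̃ = v3 Q0 0ℤ δ
    R̃ = v3 ε 0ℤ 0ℤ

    triangular-shape : b ≅ vec3 P̃ Q̃ R̃
    triangular-shape = ≅-trans triangularized
      (≅-pointwise (all3 (≋-v3 refl refl refl) (≋-v3 refl Q₁≡0 refl) (≋-v3 refl R₁≡0 R₂≡0)))

    det≡αδε : det3 b ≡ α * δ * ε
    det≡αδε = trans (sym same-det) (det-triangular P Q R Q₁≡0 R₁≡0 R₂≡0)

    -- 1 ∈ lattice forces ε = ±1, so the last generator may be replaced by 1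
    ε²≡1 : ε * ε ≡ 1ℤ
    ε²≡1 = e₀-forces-unit P0 α β Q0 δ ε (λ αδε≡0 → det≢0 (trans det≡αδε αδε≡0))
             (_≅_.to triangular-shape (e 0F) e₀∈b)
    R̃≋εe₀ : R̃ ≋ (ε ·ᵥ e 0F)
    R̃≋εe₀ = ≋-v3 (sym (ℤ.*-identityʳ ε)) (sym (ℤ.*-zeroʳ ε)) (sym (ℤ.*-zeroʳ ε))

    -- the square-free index ∣αδε∣ makes α and δ coprime, so L/ℤ is cyclic
    coprime : Σ ℤ λ σ → Σ ℤ λ τ → σ * α + τ * δ ≡ 1ℤ
    coprime = squarefree-coprime α δ ε (subst (λ z → SquareFree ∣ z ∣) det≡αδε squarefree)
    open CyclicBasis P0 α β Q0 δ (proj₁ coprime) (proj₁ (proj₂ coprime)) (proj₂ (proj₂ coprime))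

    index≡ηαδ : Σ ℤ λ η → η * η ≡ 1ℤ × + ∣ det3 b ∣ ≡ η * (α * δ)
    index≡ηαδ = abs-up-to-unit (det3 b) α δ ε ε²≡1 det≡αδε
    η : ℤ
    η = proj₁ index≡ηαδ
    η²≡1 : η * η ≡ 1ℤ
    η²≡1 = proj₁ (proj₂ index≡ηαδ)
    f≡ηαδ : + ∣ det3 b ∣ ≡ η * (α * δ)
    f≡ηαδ = proj₂ (proj₂ index≡ηαδ)

    -- b ≅ (P̃, Q̃, ε·1) ≅ (P̃, Q̃, 1) ≅ (1, W, T) = (1, f·ω₀, T)
    adapted : b ≅ vec3 (e 0F) ((+ ∣ det3 b ∣) ·ᵥ ω₀ η) T
    adapted =
      ≅-trans triangular-shape (≅-trans (≅-pointwise (all3 (λ _ → refl) (λ _ → refl) R̃≋εe₀))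
      (≅-trans (≅-unit-multiple P̃ Q̃ (e 0F) ε ε²≡1) (≅-trans same-lattice
      (≅-pointwise (all3 (λ _ → refl) (W≋fω₀ (+ ∣ det3 b ∣) η η²≡1 f≡ηαδ) (λ _ → refl))))))

open AdaptedBases

module RingLaws (R : CubicRing) where
  open import Data.Integer using (ℤ; _*_)
  import Data.Integer.Properties as ℤ
  open import Data.Integer.Tactic.RingSolver using (solve-∀)
  open CubicRing R
  open ≡-Reasoning

  mul-cong : ∀ {x x' y y'} → x ≋ x' → y ≋ y' → mul x y ≋ mul x' y'
  mul-cong x≋x' y≋y' k = sum3-cong (λ i → sum3-cong (λ j → cong₂ (λ a b → a * b * c i j k) (x≋x' i) (y≋y' j)))

  mul-congˡ : ∀ {x x'} y → x ≋ x' → mul x y ≋ mul x' y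
  mul-congˡ {x} {x'} y x≋x' = mul-cong {x} {x'} {y} {y} x≋x' (λ _ → refl)

  mul-congʳ : ∀ x {y y'} → y ≋ y' → mul x y ≋ mul x y'
  mul-congʳ x {y} {y'} y≋y' = mul-cong {x} {x} {y} {y'} (λ _ → refl) y≋y'

  mul-comm : ∀ x y → mul x y ≋ mul y x
  mul-comm x y k = begin
    sum3 (λ i → sum3 (λ j → x i * y j * c i j k))   ≡⟨ sum3-cong (λ i → sum3-cong (λ j → cong₂ _*_ (ℤ.*-comm (x i) (y j)) (comm i j k))) ⟩
    sum3 (λ i → sum3 (λ j → y j * x i * c j i k))   ≡⟨ sum3-swap (λ i j → y j * x i * c j i k) ⟩
    sum3 (λ j → sum3 (λ i → y j * x i * c j i k))   ∎

  mul-combˡ : ∀ β a y k → mul (comb β a) y k ≡ sum3 (λ l → a l * mul (β l) y k)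
  mul-combˡ β a y k = begin
    sum3 (λ i → sum3 (λ j → comb β a i * y j * c i j k))
      ≡⟨ sum3-cong (λ i → sum3-cong (λ j → distribute (λ l → a l * β l i) (y j) (c i j k))) ⟩
    sum3 (λ i → sum3 (λ j → sum3 (λ l → a l * β l i * y j * c i j k)))
      ≡⟨ sum3-cong (λ i → sum3-swap (λ j l → a l * β l i * y j * c i j k)) ⟩
    sum3 (λ i → sum3 (λ l → sum3 (λ j → a l * β l i * y j * c i j k)))
      ≡⟨ sum3-swap (λ i l → sum3 (λ j → a l * β l i * y j * c i j k)) ⟩
    sum3 (λ l → sum3 (λ i → sum3 (λ j → a l * β l i * y j * c i j k)))
      ≡⟨ sum3-cong (λ l → sum3-cong (λ i → sum3-cong (λ j → reassociate (a l) (β l i) (y j) (c i j k)))) ⟩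
    sum3 (λ l → sum3 (λ i → sum3 (λ j → a l * (β l i * y j * c i j k))))
      ≡⟨ sum3-cong (λ l → trans (sum3-cong (λ i → sym (sum3-*ˡ (a l) (λ j → β l i * y j * c i j k))))
                                (sym (sum3-*ˡ (a l) (λ i → sum3 (λ j → β l i * y j * c i j k))))) ⟩
    sum3 (λ l → a l * mul (β l) y k)
      ∎
    where
    distribute : ∀ (g : Fin 3 → ℤ) y c → sum3 g * y * c ≡ sum3 (λ l → g l * y * c)
    distribute g y c = trans (cong (_* c) (sum3-*ʳ g y)) (sum3-*ʳ (λ l → g l * y) c)
    reassociate : ∀ a b y c → a * b * y * c ≡ a * (b * y * c)
    reassociate = solve-∀

  mul-combʳ : ∀ β a x k → mul x (comb β a) k ≡ sum3 (λ l → a l * mul x (β l) k)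
  mul-combʳ β a x k =
    trans (mul-comm x (comb β a) k)
      (trans (mul-combˡ β a x k) (sum3-cong (λ l → cong (a l *_) (mul-comm (β l) x k))))

  mul-expandˡ : ∀ x y → mul x y ≋ comb (λ a → mul (e a) y) x
  mul-expandˡ x y k = trans (mul-congˡ y (comb-standard x) k) (mul-combˡ e x y k)

  mul-expandʳ : ∀ x y → mul x y ≋ comb (λ b → mul x (e b)) y
  mul-expandʳ x y k = trans (mul-congʳ x (comb-standard y) k) (mul-combʳ e y x k)

  mul-identityˡ : ∀ x → mul (e 0F) x ≋ x
  mul-identityˡ x k = trans (mul-expandʳ (e 0F) x k)
    (trans (sum3-cong (λ j → cong (x j *_) (unit j k))) (sum3-eʳ x k))

  mul-identityʳ : ∀ x → mul x (e 0F) ≋ x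
  mul-identityʳ x k = trans (mul-comm x (e 0F) k) (mul-identityˡ x k)

  expand-left : ∀ x y z k → mul (mul x y) z k
    ≡ sum3 (λ a → x a * sum3 (λ b → y b * sum3 (λ l → z l * mul (mul (e a) (e b)) (e l) k)))
  expand-left x y z k = begin
    mul (mul x y) z k
      ≡⟨ mul-congˡ z (mul-expandˡ x y) k ⟩
    mul (comb (λ a → mul (e a) y) x) z k
      ≡⟨ mul-combˡ (λ a → mul (e a) y) x z k ⟩
    sum3 (λ a → x a * mul (mul (e a) y) z k)
      ≡⟨ sum3-cong (λ a → cong (x a *_) (trans (mul-congˡ z (mul-expandʳ (e a) y) k)
                                                (mul-combˡ (λ b → mul (e a) (e b)) y z k))) ⟩
    sum3 (λ a → x a * sum3 (λ b → y b * mul (mul (e a) (e b)) z k))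
      ≡⟨ sum3-cong (λ a → cong (x a *_) (sum3-cong (λ b → cong (y b *_) (mul-expandʳ (mul (e a) (e b)) z k)))) ⟩
    sum3 (λ a → x a * sum3 (λ b → y b * sum3 (λ l → z l * mul (mul (e a) (e b)) (e l) k)))
      ∎

  expand-right : ∀ x y z k → mul x (mul y z) k
    ≡ sum3 (λ a → x a * sum3 (λ b → y b * sum3 (λ l → z l * mul (e a) (mul (e b) (e l)) k)))
  expand-right x y z k = begin
    mul x (mul y z) k
      ≡⟨ mul-expandˡ x (mul y z) k ⟩
    sum3 (λ a → x a * mul (e a) (mul y z) k)
      ≡⟨ sum3-cong (λ a → cong (x a *_) (trans (mul-congʳ (e a) (mul-expandˡ y z) k)
                                                (mul-combʳ (λ b → mul (e b) z) y (e a) k))) ⟩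
    sum3 (λ a → x a * sum3 (λ b → y b * mul (e a) (mul (e b) z) k))
      ≡⟨ sum3-cong (λ a → cong (x a *_) (sum3-cong (λ b → cong (y b *_)
           (trans (mul-congʳ (e a) (mul-expandʳ (e b) z) k) (mul-combʳ (λ l → mul (e b) (e l)) z (e a) k))))) ⟩
    sum3 (λ a → x a * sum3 (λ b → y b * sum3 (λ l → z l * mul (e a) (mul (e b) (e l)) k)))
      ∎

  mul-assoc : ∀ x y z → mul (mul x y) z ≋ mul x (mul y z)
  mul-assoc x y z k = trans (expand-left x y z k) (trans
    (sum3-cong (λ a → cong (x a *_) (sum3-cong (λ b → cong (y b *_) (sum3-cong (λ l → cong (z l *_) (assoc a b l k)))))))
    (sym (expand-right x y z k)))

  mul-bilinear : ∀ β a a' k → mul (comb β a) (comb β a') k ≡ sum3 (λ i → sum3 (λ j → a i * a' j * mul (β i) (β j) k))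
  mul-bilinear β a a' k = trans (mul-combˡ β a (comb β a') k) (sum3-cong (λ i → begin
    a i * mul (β i) (comb β a') k                     ≡⟨ cong (a i *_) (mul-combʳ β a' (β i) k) ⟩
    a i * sum3 (λ j → a' j * mul (β i) (β j) k)       ≡⟨ sum3-*ˡ (a i) (λ j → a' j * mul (β i) (β j) k) ⟩
    sum3 (λ j → a i * (a' j * mul (β i) (β j) k))     ≡⟨ sum3-cong (λ j → sym (ℤ.*-assoc (a i) (a' j) (mul (β i) (β j) k))) ⟩
    sum3 (λ j → a i * a' j * mul (β i) (β j) k)       ∎))

-- Given a basis (1, ω₀, θ₀) of O_k, write ω₀θ₀ = n₀ + n₁ω₀ + n₂θ₀ and translate:
-- ω = ω₀ - n₂, θ = θ₀ - n₁.  Then ωθ = n₀ + n₁n₂ is an integer, the determinant is unchanged,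
-- and for every f the lattices [1, fω₀, θ₀] and [1, fω, θ] coincide.
module Normalization (R : CubicRing) (ω₀ θ₀ : V) (unimodular₀ : Unimodular (vec3 (e 0F) ω₀ θ₀)) where
  open import Data.Integer using (ℤ; _+_; _*_; -_; 0ℤ; 1ℤ)
  open import Data.Integer.Tactic.RingSolver using (solve-∀)
  open CubicRing R
  open RingLaws R

  β₀ : Fin 3 → V
  β₀ = vec3 (e 0F) ω₀ θ₀

  n : Fin 3 → ℤ
  n = proj₁ (unimodular-spans β₀ unimodular₀ (mul ω₀ θ₀))
  ω₀θ₀≋ : mul ω₀ θ₀ ≋ comb β₀ n
  ω₀θ₀≋ = proj₂ (unimodular-spans β₀ unimodular₀ (mul ω₀ θ₀))

  ω θ : V
  ω = comb β₀ (v3 (- n 2F) 1ℤ 0ℤ)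
  θ = comb β₀ (v3 (- n 1F) 0ℤ 1ℤ)

  m : ℤ
  m = n 0F + n 1F * n 2F

  -- The products of the basis vectors that enter ωθ with a nonzero coefficient.
  products : Fin 3 → Fin 3 → V
  products 0F 0F = e 0F
  products 0F 2F = θ₀
  products 1F 0F = ω₀
  products 1F 2F = comb β₀ n
  products i  j  = mul (β₀ i) (β₀ j)

  product-table : ∀ i j → mul (β₀ i) (β₀ j) ≋ products i j
  product-table 0F 0F = mul-identityˡ (e 0F)
  product-table 0F 1F = λ _ → refl
  product-table 0F 2F = mul-identityˡ θ₀
  product-table 1F 0F = mul-identityʳ ω₀
  product-table 1F 1F = λ _ → refl
  product-table 1F 2F = ω₀θ₀≋
  product-table 2F 0F = λ _ → refl
  product-table 2F 1F = λ _ → refl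
  product-table 2F 2F = λ _ → refl

  -- By bilinearity  ωθ = ω₀θ₀ - n₁ω₀ - n₂θ₀ + n₁n₂ = n₀ + n₁n₂.
  ωθ≋m : mul ω θ ≋ (m ·ᵥ e 0F)
  ωθ≋m k = trans (mul-bilinear β₀ (v3 (- n 2F) 1ℤ 0ℤ) (v3 (- n 1F) 0ℤ 1ℤ) k)
    (trans (sum3-cong (λ i → sum3-cong (λ j → cong (v3 (- n 2F) 1ℤ 0ℤ i * v3 (- n 1F) 0ℤ 1ℤ j *_) (product-table i j k))))
      (expansion (n 0F) (n 1F) (n 2F) (e 0F k) (ω₀ k) (θ₀ k)
                 (products 0F 1F k) (products 1F 1F k) (products 2F 0F k) (products 2F 1F k) (products 2F 2F k)))
    where
    expansion : ∀ n0 n1 n2 E W T M01 M11 M20 M21 M22 →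
        (- n2) * (- n1) * E + (- n2) * 0ℤ * M01 + (- n2) * 1ℤ * T
      + (1ℤ * (- n1) * W + 1ℤ * 0ℤ * M11 + 1ℤ * 1ℤ * (n0 * E + n1 * W + n2 * T))
      + (0ℤ * (- n1) * M20 + 0ℤ * 0ℤ * M21 + 0ℤ * 1ℤ * M22)
      ≡ (n0 + n1 * n2) * E
    expansion = solve-∀

  -- Translation by integers is a shear of the basis, so (1, ω, θ) is still unimodular.
  unimodular : Unimodular (vec3 (e 0F) ω θ)
  unimodular = proj₁ unimodular₀ ,
    trans (cong (_* proj₁ unimodular₀) (det-shear (e 0F) ω₀ θ₀ (- n 2F) (- n 1F))) (proj₂ unimodular₀)

  -- fω and θ differ from fω₀ and θ₀ by integers.
  same-lattice : ∀ f → vec3 (e 0F) (f ·ᵥ ω₀) θ₀ ≅ vec3 (e 0F) (f ·ᵥ ω) θ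
  same-lattice f = ≅-by-generators (vec3 (e 0F) (f ·ᵥ ω₀) θ₀) (vec3 (e 0F) (f ·ᵥ ω) θ)
    (all3 (span-gen (vec3 (e 0F) (f ·ᵥ ω₀) θ₀) 0F)
          (v3 (- (f * n 2F)) 1ℤ 0ℤ , λ k → new-ω f (n 2F) (e 0F k) (ω₀ k) (θ₀ k))
          (v3 (- n 1F) 0ℤ 1ℤ , λ k → new-θ f (n 1F) (e 0F k) (ω₀ k) (θ₀ k)))
    (all3 (span-gen (vec3 (e 0F) (f ·ᵥ ω) θ) 0F)
          (v3 (f * n 2F) 1ℤ 0ℤ , λ k → old-ω f (n 1F) (n 2F) (e 0F k) (ω₀ k) (θ₀ k))
          (v3 (n 1F) 0ℤ 1ℤ , λ k → old-θ f (n 1F) (n 2F) (e 0F k) (ω₀ k) (θ₀ k)))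
    where
    new-ω : ∀ f n2 E W T → f * ((- n2) * E + 1ℤ * W + 0ℤ * T) ≡ (- (f * n2)) * E + 1ℤ * (f * W) + 0ℤ * T
    new-ω = solve-∀
    new-θ : ∀ f n1 E W T → (- n1) * E + 0ℤ * W + 1ℤ * T ≡ (- n1) * E + 0ℤ * (f * W) + 1ℤ * T
    new-θ = solve-∀
    old-ω : ∀ f n1 n2 E W T → f * W ≡ (f * n2) * E + 1ℤ * (f * ((- n2) * E + 1ℤ * W + 0ℤ * T))
                                     + 0ℤ * ((- n1) * E + 0ℤ * W + 1ℤ * T)
    old-ω = solve-∀
    old-θ : ∀ f n1 n2 E W T → T ≡ n1 * E + 0ℤ * (f * ((- n2) * E + 1ℤ * W + 0ℤ * T))
                                 + 1ℤ * ((- n1) * E + 0ℤ * W + 1ℤ * T)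
    old-θ = solve-∀

module Conductor (R : CubicRing) (O : Order R) (f : ℤ) (ω θ : V) (m : ℤ)
                 (unimodular : Unimodular (vec3 (e 0F) ω θ))
                 (ωθ≋m : CubicRing.mul R ω θ ≋ (m ·ᵥ e 0F))
                 (O≅ : Order.basis O ≅ vec3 (e 0F) (f ·ᵥ ω) θ) where
  import Data.Nat as ℕ
  import Data.Nat.Properties as ℕ
  open import Data.Integer using (ℤ; ∣_∣; _+_; _*_; -_; _-_; 0ℤ; 1ℤ)
  import Data.Integer.Properties as ℤ
  open import Data.Integer.Tactic.RingSolver using (solve-∀)
  open CubicRing R
  open RingLaws R
  open ≡-Reasoning

  β 𝔬 𝔣 : Fin 3 → V
  β = vec3 (e 0F) ω θ
  𝔬 = vec3 (e 0F) (f ·ᵥ ω) θ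
  𝔣 = vec3 (f ·ᵥ e 0F) (f ·ᵥ ω) θ

  det-β≢0 : ¬ det3 β ≡ 0ℤ
  det-β≢0 det≡0 = 0≢1 (trans (cong (_* proj₁ unimodular) (sym det≡0)) (proj₂ unimodular))
    where
    0≢1 : ¬ 0ℤ ≡ 1ℤ
    0≢1 ()

  ω²-coords θ²-coords : Fin 3 → ℤ
  ω²-coords = proj₁ (unimodular-spans β unimodular (mul ω ω))
  θ²-coords = proj₁ (unimodular-spans β unimodular (mul θ θ))
  A₁ B₁ C₁ A₂ B₂ C₂ : ℤ
  A₁ = ω²-coords 0F
  B₁ = ω²-coords 1F
  C₁ = ω²-coords 2F
  A₂ = θ²-coords 0F
  B₂ = θ²-coords 1F
  C₂ = θ²-coords 2F

  products : Fin 3 → Fin 3 → V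
  products 0F 0F = e 0F
  products 0F 1F = ω
  products 0F 2F = θ
  products 1F 0F = ω
  products 1F 1F = comb β ω²-coords
  products 1F 2F = m ·ᵥ e 0F
  products 2F 0F = θ
  products 2F 1F = m ·ᵥ e 0F
  products 2F 2F = comb β θ²-coords

  product-table : ∀ i j → mul (β i) (β j) ≋ products i j
  product-table 0F 0F = mul-identityˡ (e 0F)
  product-table 0F 1F = mul-identityˡ ω
  product-table 0F 2F = mul-identityˡ θ
  product-table 1F 0F = mul-identityʳ ω
  product-table 1F 1F = proj₂ (unimodular-spans β unimodular (mul ω ω))
  product-table 1F 2F = ωθ≋m
  product-table 2F 0F = mul-identityʳ θ
  product-table 2F 1F = λ k → trans (mul-comm θ ω k) (ωθ≋m k)
  product-table 2F 2F = proj₂ (unimodular-spans β unimodular (mul θ θ))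

  _⊙_ : (Fin 3 → ℤ) → (Fin 3 → ℤ) → Fin 3 → ℤ
  (x ⊙ y) 0F = x 0F * y 0F + (x 1F * y 2F + x 2F * y 1F) * m + x 1F * y 1F * A₁ + x 2F * y 2F * A₂
  (x ⊙ y) 1F = x 0F * y 1F + x 1F * y 0F + x 1F * y 1F * B₁ + x 2F * y 2F * B₂
  (x ⊙ y) 2F = x 0F * y 2F + x 2F * y 0F + x 1F * y 1F * C₁ + x 2F * y 2F * C₂

  mul-coords : ∀ x y → mul (comb β x) (comb β y) ≋ comb β (x ⊙ y)
  mul-coords x y k = trans (mul-bilinear β x y k)
    (trans (sum3-cong (λ i → sum3-cong (λ j → cong (x i * y j *_) (product-table i j k))))
           (expansion (x 0F) (x 1F) (x 2F) (y 0F) (y 1F) (y 2F) (e 0F k) (ω k) (θ k) A₁ B₁ C₁ m A₂ B₂ C₂))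
    where
    expansion : ∀ x0 x1 x2 y0 y1 y2 E W T A1 B1 C1 m A2 B2 C2 →
        x0 * y0 * E + x0 * y1 * W + x0 * y2 * T
      + (x1 * y0 * W + x1 * y1 * (A1 * E + B1 * W + C1 * T) + x1 * y2 * (m * E))
      + (x2 * y0 * T + x2 * y1 * (m * E) + x2 * y2 * (A2 * E + B2 * W + C2 * T))
      ≡ (x0 * y0 + (x1 * y2 + x2 * y1) * m + x1 * y1 * A1 + x2 * y2 * A2) * E
      + (x0 * y1 + x1 * y0 + x1 * y1 * B1 + x2 * y2 * B2) * W
      + (x0 * y2 + x2 * y0 + x1 * y1 * C1 + x2 * y2 * C2) * T
    expansion = solve-∀

  -- Associativity of O_k makes ⊙ associative, since β-coordinates are unique.
  ⊙-assoc : ∀ x y z i → ((x ⊙ y) ⊙ z) i ≡ (x ⊙ (y ⊙ z)) i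
  ⊙-assoc x y z = coords-unique β ((x ⊙ y) ⊙ z) (x ⊙ (y ⊙ z)) det-β≢0 (λ _ → refl) (λ k → begin
    comb β ((x ⊙ y) ⊙ z) k                     ≡⟨ sym (mul-coords (x ⊙ y) z k) ⟩
    mul (comb β (x ⊙ y)) (comb β z) k          ≡⟨ mul-congˡ (comb β z) (λ k' → sym (mul-coords x y k')) k ⟩
    mul (mul (comb β x) (comb β y)) (comb β z) k ≡⟨ mul-assoc (comb β x) (comb β y) (comb β z) k ⟩
    mul (comb β x) (mul (comb β y) (comb β z)) k ≡⟨ mul-congʳ (comb β x) (mul-coords y z) k ⟩
    mul (comb β x) (comb β (y ⊙ z)) k          ≡⟨ mul-coords x (y ⊙ z) k ⟩
    comb β (x ⊙ (y ⊙ z)) k                     ∎)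

  -- Comparing ω-coordinates in (ω²)θ = ω(ωθ) and in (θ²)ω = θ(θω); the identities below are the
  -- coordinate-1 entries of (e₁ ⊙ e₁) ⊙ e₂, e₁ ⊙ (e₁ ⊙ e₂), (e₂ ⊙ e₂) ⊙ e₁ and e₂ ⊙ (e₂ ⊙ e₁).
  m≡C₁B₂ : m ≡ C₁ * B₂
  m≡C₁B₂ = trans (sym (right A₁ B₁ C₁ m A₂ B₂ C₂))
             (trans (sym (⊙-assoc (e 1F) (e 1F) (e 2F) 1F)) (left A₁ B₁ C₁ m A₂ B₂ C₂))
    where
    left : ∀ A1 B1 C1 m A2 B2 C2 →
      let p0 = 0ℤ * 0ℤ + (1ℤ * 0ℤ + 0ℤ * 1ℤ) * m + 1ℤ * 1ℤ * A1 + 0ℤ * 0ℤ * A2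
          p1 = 0ℤ * 1ℤ + 1ℤ * 0ℤ + 1ℤ * 1ℤ * B1 + 0ℤ * 0ℤ * B2
          p2 = 0ℤ * 0ℤ + 0ℤ * 0ℤ + 1ℤ * 1ℤ * C1 + 0ℤ * 0ℤ * C2
      in p0 * 0ℤ + p1 * 0ℤ + p1 * 0ℤ * B1 + p2 * 1ℤ * B2 ≡ C1 * B2
    left = solve-∀
    right : ∀ A1 B1 C1 m A2 B2 C2 →
      let p0 = 0ℤ * 0ℤ + (1ℤ * 1ℤ + 0ℤ * 0ℤ) * m + 1ℤ * 0ℤ * A1 + 0ℤ * 1ℤ * A2
          p1 = 0ℤ * 0ℤ + 1ℤ * 0ℤ + 1ℤ * 0ℤ * B1 + 0ℤ * 1ℤ * B2
          p2 = 0ℤ * 1ℤ + 0ℤ * 0ℤ + 1ℤ * 0ℤ * C1 + 0ℤ * 1ℤ * C2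
      in 0ℤ * p1 + 1ℤ * p0 + 1ℤ * p1 * B1 + 0ℤ * p2 * B2 ≡ m
    right = solve-∀

  A₂+B₂B₁≡0 : A₂ + B₂ * B₁ ≡ 0ℤ
  A₂+B₂B₁≡0 = trans (sym (left A₁ B₁ C₁ m A₂ B₂ C₂))
                (trans (⊙-assoc (e 2F) (e 2F) (e 1F) 1F) (right A₁ B₁ C₁ m A₂ B₂ C₂))
    where
    left : ∀ A1 B1 C1 m A2 B2 C2 →
      let p0 = 0ℤ * 0ℤ + (0ℤ * 1ℤ + 1ℤ * 0ℤ) * m + 0ℤ * 0ℤ * A1 + 1ℤ * 1ℤ * A2
          p1 = 0ℤ * 0ℤ + 0ℤ * 0ℤ + 0ℤ * 0ℤ * B1 + 1ℤ * 1ℤ * B2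
          p2 = 0ℤ * 1ℤ + 1ℤ * 0ℤ + 0ℤ * 0ℤ * C1 + 1ℤ * 1ℤ * C2
      in p0 * 1ℤ + p1 * 0ℤ + p1 * 1ℤ * B1 + p2 * 0ℤ * B2 ≡ A2 + B2 * B1
    left = solve-∀
    right : ∀ A1 B1 C1 m A2 B2 C2 →
      let p0 = 0ℤ * 0ℤ + (0ℤ * 0ℤ + 1ℤ * 1ℤ) * m + 0ℤ * 1ℤ * A1 + 1ℤ * 0ℤ * A2
          p1 = 0ℤ * 1ℤ + 0ℤ * 0ℤ + 0ℤ * 1ℤ * B1 + 1ℤ * 0ℤ * B2
          p2 = 0ℤ * 0ℤ + 1ℤ * 0ℤ + 0ℤ * 1ℤ * C1 + 1ℤ * 0ℤ * C2
      in 0ℤ * p1 + 0ℤ * p0 + 0ℤ * p1 * B1 + 1ℤ * p2 * B2 ≡ 0ℤ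
    right = solve-∀

  𝔬-coords : ∀ a k → comb 𝔬 a k ≡ comb β (v3 (a 0F) (f * a 1F) (a 2F)) k
  𝔬-coords a k = identity (a 0F) (a 1F) (a 2F) f (e 0F k) (ω k) (θ k)
    where
    identity : ∀ a0 a1 a2 f E W T → a0 * E + a1 * (f * W) + a2 * T ≡ a0 * E + f * a1 * W + a2 * T
    identity = solve-∀

  𝔣-coords : ∀ a k → comb 𝔣 a k ≡ comb β (v3 (f * a 0F) (f * a 1F) (a 2F)) k
  𝔣-coords a k = identity (a 0F) (a 1F) (a 2F) f (e 0F k) (ω k) (θ k)
    where
    identity : ∀ a0 a1 a2 f E W T → a0 * (f * E) + a1 * (f * W) + a2 * T ≡ f * a0 * E + f * a1 * W + a2 * T
    identity = solve-∀

  in-𝔬 : ∀ {x} a0 a1 a2 → x ≋ comb β (v3 a0 (f * a1) a2) → Span 𝔬 x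
  in-𝔬 a0 a1 a2 x≋ = v3 a0 a1 a2 , λ k → trans (x≋ k) (sym (𝔬-coords (v3 a0 a1 a2) k))

  from-𝔬 : ∀ {x} → Span 𝔬 x → Σ (Fin 3 → ℤ) λ a → x ≋ comb β (v3 (a 0F) (f * a 1F) (a 2F))
  from-𝔬 (a , x≋) = a , λ k → trans (x≋ k) (𝔬-coords a k)

  in-𝔣 : ∀ {x} a0 a1 a2 → x ≋ comb β (v3 (f * a0) (f * a1) a2) → Span 𝔣 x
  in-𝔣 a0 a1 a2 x≋ = v3 a0 a1 a2 , λ k → trans (x≋ k) (sym (𝔣-coords (v3 a0 a1 a2) k))

  from-𝔣 : ∀ {x} → Span 𝔣 x → Σ (Fin 3 → ℤ) λ a → x ≋ comb β (v3 (f * a 0F) (f * a 1F) (a 2F))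
  from-𝔣 (a , x≋) = a , λ k → trans (x≋ k) (𝔣-coords a k)

  -- Since θ² ∈ O, its ω-coordinate B₂ is divisible by f; by the relations above so are m and A₂.
  θ²∈𝔬 : Span 𝔬 (mul θ θ)
  θ²∈𝔬 = _≅_.to O≅ (mul θ θ) (Order.mulClosed O θ θ θ∈O θ∈O)
    where
    θ∈O : Span (Order.basis O) θ
    θ∈O = _≅_.from O≅ θ (span-gen 𝔬 2F)

  q : ℤ
  q = proj₁ (from-𝔬 θ²∈𝔬) 1F

  B₂≡fq : B₂ ≡ f * q
  B₂≡fq = coords-unique β θ²-coords (v3 (a 0F) (f * a 1F) (a 2F)) det-β≢0
            (product-table 2F 2F) (proj₂ (from-𝔬 θ²∈𝔬)) 1F
    where
    a : Fin 3 → ℤ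
    a = proj₁ (from-𝔬 θ²∈𝔬)

  m≡f·C₁q : m ≡ f * (C₁ * q)
  m≡f·C₁q = trans m≡C₁B₂ (trans (cong (C₁ *_) B₂≡fq) (identity C₁ f q))
    where
    identity : ∀ C₁ f q → C₁ * (f * q) ≡ f * (C₁ * q)
    identity = solve-∀

  A₂≡f·-qB₁ : A₂ ≡ f * (- (q * B₁))
  A₂≡f·-qB₁ = begin
    A₂                          ≡⟨ identity₁ A₂ B₂ B₁ ⟩
    (A₂ + B₂ * B₁) - B₂ * B₁    ≡⟨ cong₂ (λ s b → s - b * B₁) A₂+B₂B₁≡0 B₂≡fq ⟩
    0ℤ - f * q * B₁             ≡⟨ identity₂ f q B₁ ⟩
    f * (- (q * B₁))            ∎
    where
    identity₁ : ∀ A B B′ → A ≡ (A + B * B′) - B * B′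
    identity₁ = solve-∀
    identity₂ : ∀ f q B → 0ℤ - f * q * B ≡ f * (- (q * B))
    identity₂ = solve-∀

  -- 𝔣 is an O_k-ideal: the β-coordinates of r·x, for x ∈ 𝔣, are again (f·_, f·_, _).
  𝔣-mul : ∀ r x → Span 𝔣 x → Span 𝔣 (mul r x)
  𝔣-mul r x x∈𝔣 = in-𝔣 U W′ ((ρ ⊙ X) 2F) (λ k → begin
      mul r x k                ≡⟨ mul-cong ρ-coords a-coords k ⟩
      mul (comb β ρ) (comb β X) k ≡⟨ mul-coords ρ X k ⟩
      comb β (ρ ⊙ X) k         ≡⟨ comb-coeff-cong β (ρ ⊙ X) (v3 (f * U) (f * W′) ((ρ ⊙ X) 2F))
                                                  (all3 coordinate₀ coordinate₁ refl) k ⟩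
      comb β (v3 (f * U) (f * W′) ((ρ ⊙ X) 2F)) k ∎)
    where
    ρ a X : Fin 3 → ℤ
    ρ = proj₁ (unimodular-spans β unimodular r)
    ρ-coords : r ≋ comb β ρ
    ρ-coords = proj₂ (unimodular-spans β unimodular r)
    a = proj₁ (from-𝔣 x∈𝔣)
    a-coords : x ≋ comb β (v3 (f * a 0F) (f * a 1F) (a 2F))
    a-coords = proj₂ (from-𝔣 x∈𝔣)
    X = v3 (f * a 0F) (f * a 1F) (a 2F)
    U W′ : ℤ
    U  = ρ 0F * a 0F + ρ 1F * a 2F * (C₁ * q) + ρ 2F * a 1F * (f * (C₁ * q))
       + ρ 1F * a 1F * A₁ + ρ 2F * a 2F * (- (q * B₁))
    W′ = ρ 0F * a 1F + ρ 1F * a 0F + ρ 1F * a 1F * B₁ + ρ 2F * a 2F * q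
    coordinate₀ : (ρ ⊙ X) 0F ≡ f * U
    coordinate₀ = trans
      (cong₂ (λ m′ A₂′ → ρ 0F * (f * a 0F) + (ρ 1F * a 2F + ρ 2F * (f * a 1F)) * m′
                          + ρ 1F * (f * a 1F) * A₁ + ρ 2F * a 2F * A₂′)
             m≡f·C₁q A₂≡f·-qB₁)
      (identity (ρ 0F) (ρ 1F) (ρ 2F) (a 0F) (a 1F) (a 2F) f A₁ (C₁ * q) (- (q * B₁)))
      where
      identity : ∀ r0 r1 r2 a0 a1 a2 f A mq aq →
          r0 * (f * a0) + (r1 * a2 + r2 * (f * a1)) * (f * mq) + r1 * (f * a1) * A + r2 * a2 * (f * aq)
        ≡ f * (r0 * a0 + r1 * a2 * mq + r2 * a1 * (f * mq) + r1 * a1 * A + r2 * a2 * aq)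
      identity = solve-∀
    coordinate₁ : (ρ ⊙ X) 1F ≡ f * W′
    coordinate₁ = trans
      (cong (λ B₂′ → ρ 0F * (f * a 1F) + ρ 1F * (f * a 0F) + ρ 1F * (f * a 1F) * B₁ + ρ 2F * a 2F * B₂′) B₂≡fq)
      (identity (ρ 0F) (ρ 1F) (ρ 2F) (a 0F) (a 1F) (a 2F) f B₁ q)
      where
      identity : ∀ r0 r1 r2 a0 a1 a2 f B q →
          r0 * (f * a1) + r1 * (f * a0) + r1 * (f * a1) * B + r2 * a2 * (f * q)
        ≡ f * (r0 * a1 + r1 * a0 + r1 * a1 * B + r2 * a2 * q)
      identity = solve-∀

  𝔣-ideal : IsIdeal R (Span 𝔣)
  𝔣-ideal = (λ x y x≋y → span-resp 𝔣 x≋y) , span-zero 𝔣 , (λ x y → span-+ 𝔣) , (λ x → span-neg 𝔣) , 𝔣-mul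

  𝔣⊆O : Span 𝔣 ⊆ Span (Order.basis O)
  𝔣⊆O x x∈𝔣 = _≅_.from O≅ x (in-𝔬 (f * a 0F) (a 1F) (a 2F) (proj₂ (from-𝔣 x∈𝔣)))
    where
    a : Fin 3 → ℤ
    a = proj₁ (from-𝔣 x∈𝔣)

  -- 𝔣 is the largest ideal inside O: for x = a₀ + f a₁ω + a₂θ in such an ideal, ωx ∈ O has
  -- ω-coordinate a₀ + f a₁B₁ ≡ 0 (mod f), so f ∣ a₀.
  𝔣-largest : ∀ I → IsIdeal R I → I ⊆ Span (Order.basis O) → I ⊆ Span 𝔣
  𝔣-largest I I-ideal I⊆O x x∈I =
    in-𝔣 (b 1F - a 1F * B₁) (a 1F) (a 2F) (λ k → trans (a-coords k)
      (comb-coeff-cong β X (v3 (f * (b 1F - a 1F * B₁)) (f * a 1F) (a 2F)) (all3 a₀≡f·_ refl refl) k))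
    where
    a b X : Fin 3 → ℤ
    a = proj₁ (from-𝔬 (_≅_.to O≅ x (I⊆O x x∈I)))
    a-coords : x ≋ comb β (v3 (a 0F) (f * a 1F) (a 2F))
    a-coords = proj₂ (from-𝔬 (_≅_.to O≅ x (I⊆O x x∈I)))
    X = v3 (a 0F) (f * a 1F) (a 2F)
    ωx∈I : I (mul ω x)
    ωx∈I = proj₂ (proj₂ (proj₂ (proj₂ I-ideal))) ω x x∈I
    b = proj₁ (from-𝔬 (_≅_.to O≅ (mul ω x) (I⊆O (mul ω x) ωx∈I)))
    b-coords : mul ω x ≋ comb β (v3 (b 0F) (f * b 1F) (b 2F))
    b-coords = proj₂ (from-𝔬 (_≅_.to O≅ (mul ω x) (I⊆O (mul ω x) ωx∈I)))
    ωx-coords : mul ω x ≋ comb β (e 1F ⊙ X)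
    ωx-coords k = trans (mul-cong (λ k′ → sym (comb-e β 1F k′)) a-coords k) (mul-coords (e 1F) X k)
    ω-coordinate : (e 1F ⊙ X) 1F ≡ f * b 1F
    ω-coordinate = coords-unique β (e 1F ⊙ X) (v3 (b 0F) (f * b 1F) (b 2F)) det-β≢0 ωx-coords b-coords 1F
    a₀≡f·_ : a 0F ≡ f * (b 1F - a 1F * B₁)
    a₀≡f·_ = begin
      a 0F                                           ≡⟨ identity₁ (a 0F) (a 1F) (a 2F) f B₁ B₂ ⟩
      (e 1F ⊙ X) 1F - f * a 1F * B₁                  ≡⟨ cong (_- f * a 1F * B₁) ω-coordinate ⟩
      f * b 1F - f * a 1F * B₁                       ≡⟨ identity₂ f (b 1F) (a 1F) B₁ ⟩
      f * (b 1F - a 1F * B₁)                         ∎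
      where
      identity₁ : ∀ a0 a1 a2 f B₁ B₂ → a0 ≡ 0ℤ * (f * a1) + 1ℤ * a0 + 1ℤ * (f * a1) * B₁ + 0ℤ * a2 * B₂ - f * a1 * B₁
      identity₁ = solve-∀
      identity₂ : ∀ f b a B → f * b - f * a * B ≡ f * (b - a * B)
      identity₂ = solve-∀

  O⊆ℤ+𝔣 : ∀ x → Span (Order.basis O) x → ∃ λ (n : ℤ) → ∃ λ (y : V) → Span 𝔣 y × (x ≋ ((n ·ᵥ e 0F) +ᵥ y))
  O⊆ℤ+𝔣 x x∈O = a 0F , comb β (v3 (f * 0ℤ) (f * a 1F) (a 2F)) , in-𝔣 0ℤ (a 1F) (a 2F) (λ _ → refl)
    , λ k → trans (a-coords k) (split (a 0F) (a 1F) (a 2F) f (e 0F k) (ω k) (θ k))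
    where
    a : Fin 3 → ℤ
    a = proj₁ (from-𝔬 (_≅_.to O≅ x x∈O))
    a-coords : x ≋ comb β (v3 (a 0F) (f * a 1F) (a 2F))
    a-coords = proj₂ (from-𝔬 (_≅_.to O≅ x x∈O))
    split : ∀ a0 a1 a2 f E W T → a0 * E + f * a1 * W + a2 * T ≡ a0 * E + (f * 0ℤ * E + f * a1 * W + a2 * T)
    split = solve-∀

  ℤ+𝔣⊆O : ∀ x → (∃ λ (n : ℤ) → ∃ λ (y : V) → Span 𝔣 y × (x ≋ ((n ·ᵥ e 0F) +ᵥ y))) → Span (Order.basis O) x
  ℤ+𝔣⊆O x (n , y , y∈𝔣 , x≋) = _≅_.from O≅ x (in-𝔬 (n + f * b 0F) (b 1F) (b 2F) (λ k →
      trans (x≋ k) (trans (cong (n * e 0F k +_) (b-coords k)) (merge n (b 0F) (b 1F) (b 2F) f (e 0F k) (ω k) (θ k)))))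
    where
    b : Fin 3 → ℤ
    b = proj₁ (from-𝔣 y∈𝔣)
    b-coords : y ≋ comb β (v3 (f * b 0F) (f * b 1F) (b 2F))
    b-coords = proj₂ (from-𝔣 y∈𝔣)
    merge : ∀ n b0 b1 b2 f E W T → n * E + (f * b0 * E + f * b1 * W + b2 * T) ≡ (n + f * b0) * E + f * b1 * W + b2 * T
    merge = solve-∀

  ∣det-β∣≡1 : ∣ det3 β ∣ ≡ 1
  ∣det-β∣≡1 = unit⇒abs≡1 (det3 β) (proj₁ unimodular) (proj₂ unimodular)

  norm-𝔣 : ∣ det3 𝔣 ∣ ≡ ∣ f ∣ ℕ.* ∣ f ∣
  norm-𝔣 = begin
    ∣ det3 𝔣 ∣                    ≡⟨ cong ∣_∣ (det-scale f (e 0F) ω θ) ⟩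
    ∣ f * f * det3 β ∣            ≡⟨ ℤ.abs-* (f * f) (det3 β) ⟩
    ∣ f * f ∣ ℕ.* ∣ det3 β ∣      ≡⟨ cong₂ ℕ._*_ (ℤ.abs-* f f) ∣det-β∣≡1 ⟩
    (∣ f ∣ ℕ.* ∣ f ∣) ℕ.* 1       ≡⟨ ℕ.*-identityʳ (∣ f ∣ ℕ.* ∣ f ∣) ⟩
    ∣ f ∣ ℕ.* ∣ f ∣               ∎

open import Data.Nat using (_*_)
open import Data.Integer using (+_; ∣_∣)
open import Function.Bundles using (_⇔_; mk⇔)

proposition2p4 : (R : CubicRing) → Reduced R → Maximal R → (O : Order R)
    → SquareFree (index O)
    → ∃ λ (ω : V) → ∃ λ (θ : V)
      → (∣ det3 (vec3 (e 0F) ω θ) ∣ ≡ 1)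
      × (∃ λ (m : ℤ) → CubicRing.mul R ω θ ≋ (m ·ᵥ e 0F))
      × (∀ x → Span (Order.basis O) x ⇔ Span (vec3 (e 0F) ((+ index O) ·ᵥ ω) θ) x)
      × IsConductor R O (Span (vec3 ((+ index O) ·ᵥ e 0F) ((+ index O) ·ᵥ ω) θ))
      × (∀ x → Span (Order.basis O) x ⇔ (∃ λ (n : ℤ) → ∃ λ (y : V)
            → Span (vec3 ((+ index O) ·ᵥ e 0F) ((+ index O) ·ᵥ ω) θ) y
            × (x ≋ ((n ·ᵥ e 0F) +ᵥ y))))
      × (∣ det3 (vec3 ((+ index O) ·ᵥ e 0F) ((+ index O) ·ᵥ ω) θ) ∣ ≡ index O * index O)
proposition2p4 R _ _ O squarefree =
  ω , θ , ∣det-β∣≡1 , (m , ωθ≋m) , (λ x → mk⇔ (_≅_.to O≅ x) (_≅_.from O≅ x))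
    , (𝔣-ideal , 𝔣⊆O , 𝔣-largest) , (λ x → mk⇔ (O⊆ℤ+𝔣 x) (ℤ+𝔣⊆O x)) , norm-𝔣
  where
  f : ℤ
  f = + index O

  A : AdaptedBasis (Order.basis O) f
  A = adapted-basis (Order.basis O) (Order.fullRank O) (Order.hasOne O) squarefree
  open AdaptedBasis A using (ω₀; θ₀) renaming (unimodular to unimodular₀)

  open Normalization R ω₀ θ₀ unimodular₀ using (ω; θ; m; ωθ≋m; unimodular)
  O≅ : Order.basis O ≅ vec3 (e 0F) (f ·ᵥ ω) θ
  O≅ = ≅-trans (AdaptedBasis.same-lattice A) (Normalization.same-lattice R ω₀ θ₀ unimodular₀ f)

  open Conductor R O f ω θ m unimodular ωθ≋m O≅
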